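{- Let $\mathcal{J}=\{J_1,\ldots,J_n\}$ be a set of time-dependent tasks, $J_j$ having integer deadline $d_j$ and nondecreasing execution-time function $p_j\colon\{0,\ldots,d_j-1\}\to\mathbb{N}_+$, let $f_j=\max\{t\in\mathbb{N}\colon t+p_j(t)\le d_j\}$ and $L=\max_j d_j$. Let $T$ be the tree rooted at $r$ built as follows: for each $j$ a path $P_j$ with vertices $u_j^i,v_j^i$ ($i=0,\ldots,f_j$) and edges $u_j^iv_j^i$ ($i=0,\ldots,f_j$) and $v_j^iu_j^{i+1}$ ($i=0,\ldots,f_j-1$); further vertices $r$ and $y_j,z_j$ for $j=0,\ldots,n$; $r$ is adjacent to $y_0$ and to $u_j^{f_j}$ for each $j=1,\ldots,n$; $v_j^0$ is adjacent to $y_j$ for $j=1,\ldots,n$; and $y_j$ is adjacent to $z_j$ for $j=0,\ldots,n$. All edges have weight $1$, and the vertex weights are $w(r)=2L$, $w(y_j)=3L$, $w(z_j)=1$ ($j=0,\ldots,n$), $w(u_j^i)=2L-i$ and $w(v_j^i)=p_j(i)$ ($j=1,\ldots,n$, $i=0,\ldots,f_j$). If there exists a feasible schedule for $\mathcal{J}$, then there exists a connected $4L$-search strategy for $T$ with starting vertex $r$.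
   Context: A feasible single-machine schedule for time-dependent tasks assigns to each task $J_j$ an integer start time $s_j\ge 0$ with completion time $C_j=s_j+p_j(s_j)\le d_j$, the intervals $[s_j,C_j)$ being pairwise disjoint. Connected searching of a weighted graph ($w$ on vertices and edges, positive integers): a connected $k$-search strategy starts with all edges contaminated and $k$ searchers on the starting vertex; each move slides $j\ge1$ searchers along an edge $e$, requiring $j\ge w(e)$ if $e$ is contaminated, which then becomes clear; an edge $uv$ becomes contaminated whenever some edge $vy$ is contaminated and fewer than $w(v)$ searchers occupy $v$; the clear edges must form a connected subgraph after every move, and all edges are clear at the end. -}

module Defs where

open import Data.Nat using (ℕ; zero; suc; _+_; _*_; _∸_; _≤_; _<_; _⊔_)
open import Data.Fin using (Fin; toℕ; fromℕ; inject₁)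
import Data.Fin as F
open import Data.Bool using (Bool; true; false)
open import Data.Product using (Σ; ∃; _×_; _,_; proj₁; proj₂)
open import Data.Sum using (_⊎_)
open import Relation.Nullary using (¬_)
open import Relation.Binary.PropositionalEquality using (_≡_; _≢_)

-- A task family: n tasks (task J_{j+1} is indexed by j : Fin n),
-- deadlines d j, execution-time functions p j.  p j is only meaningful
-- on {0,…,d j - 1}; every condition below only uses it there.

record FeasibleSchedule (n : ℕ) (d : Fin n → ℕ) (p : Fin n → ℕ → ℕ) : Set where
  field
    s        : Fin n → ℕ
    inDomain : ∀ j → s j < d j
    deadline : ∀ j → s j + p j (s j) ≤ d j
    disjoint : ∀ j k → j ≢ k →
               (s j + p j (s j) ≤ s k) ⊎ (s k + p k (s k) ≤ s j)

-- f is the maximum of { t ∈ ℕ : t < d, t + p t ≤ d }  (t < d is the domain of p).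
record IsLatestStart (d : ℕ) (p : ℕ → ℕ) (f : ℕ) : Set where
  field
    domain   : f < d
    fits     : f + p f ≤ d
    greatest : ∀ t → t < d → t + p t ≤ d → t ≤ f

maxFin : (n : ℕ) → (Fin n → ℕ) → ℕ
maxFin zero    g = 0
maxFin (suc n) g = g F.zero ⊔ maxFin n (λ i → g (F.suc i))

record WGraph : Set₁ where
  field
    V    : Set
    E    : Set
    ends : E → V × V
    wv   : V → ℕ
    we   : E → ℕ

module _ (G : WGraph) where
  open WGraph G

  Incident : V → E → Set
  Incident x e = (proj₁ (ends e) ≡ x) ⊎ (proj₂ (ends e) ≡ x)

  -- state: number of searchers on each vertex, and contamination flag
  -- of each edge (true = contaminated, false = clear)
  record State : Set where
    constructor ⟨_,_⟩
    field
      σ : V → ℕ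
      κ : E → Bool

  data Recont (σ : V → ℕ) (C0 : E → Set) : E → Set where
    base   : ∀ {e} → C0 e → Recont σ C0 e
    spread : ∀ {e e' x} → Recont σ C0 e → Incident x e → Incident x e' →
             σ x < wv x → Recont σ C0 e'

  oriented : Bool → E → V × V
  oriented true  e = ends e
  oriented false e = proj₂ (ends e) , proj₁ (ends e)

  record Step (s s' : State) : Set where
    open State s
    open State s' renaming (σ to σ'; κ to κ')
    field
      e       : E
      dir     : Bool
      j       : ℕ
    x = proj₁ (oriented dir e)
    y = proj₂ (oriented dir e)
    field
      j≥1      : 1 ≤ j
      enough   : j ≤ σ x
      weight   : κ e ≡ true → we e ≤ j
      leave    : σ' x + j ≡ σ x
      arrive   : σ' y ≡ σ y + j
      others   : ∀ v → v ≢ x → v ≢ y → σ' v ≡ σ v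
      contam   : ∀ e' → κ' e' ≡ true →
                   Recont σ' (λ e'' → (κ e'' ≡ true) × (e'' ≢ e)) e'
      contam⁻¹ : ∀ e' → Recont σ' (λ e'' → (κ e'' ≡ true) × (e'' ≢ e)) e' →
                   κ' e' ≡ true

  data Linked (κ : E → Bool) : E → E → Set where
    here : ∀ {e} → Linked κ e e
    next : ∀ {e₁ e₂ e₃ x} → Linked κ e₁ e₂ → Incident x e₂ → Incident x e₃ →
           κ e₃ ≡ false → Linked κ e₁ e₃

  ClearConnected : (E → Bool) → Set
  ClearConnected κ = ∀ e₁ e₂ → κ e₁ ≡ false → κ e₂ ≡ false → Linked κ e₁ e₂

  AllClear : (E → Bool) → Set
  AllClear κ = ∀ e → κ e ≡ false

  data StrategyFrom : State → Set where
    done : ∀ {s} → AllClear (State.κ s) → StrategyFrom s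
    step : ∀ {s s'} → Step s s' → ClearConnected (State.κ s') →
           StrategyFrom s' → StrategyFrom s

  record ConnectedSearch (k : ℕ) (v₀ : V) : Set where
    field
      σ₀      : V → ℕ
      atStart : σ₀ v₀ ≡ k
      empty   : ∀ v → v ≢ v₀ → σ₀ v ≡ 0
      strategy : StrategyFrom ⟨ σ₀ , (λ _ → true) ⟩

module _ (n : ℕ) (f : Fin n → ℕ) where
  -- task J_{j+1} ↔ j : Fin n ;  y, z indexed by Fin (suc n) = {0,…,n},
  -- task J_{j+1} uses y (F.suc j).
  data TV : Set where
    r    : TV
    y z  : Fin (suc n) → TV
    u v  : (j : Fin n) → Fin (suc (f j)) → TV

  data TE : Set where
    uv  : (j : Fin n) → Fin (suc (f j)) → TE
    vu  : (j : Fin n) → Fin (f j) → TE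
    ry₀ : TE
    ru  : Fin n → TE
    vy  : Fin n → TE
    yz  : Fin (suc n) → TE

  TEnds : TE → TV × TV
  TEnds (uv j i) = u j i , v j i
  TEnds (vu j i) = v j (inject₁ i) , u j (F.suc i)
  TEnds ry₀      = r , y F.zero
  TEnds (ru j)   = r , u j (fromℕ (f j))
  TEnds (vy j)   = v j F.zero , y (F.suc j)
  TEnds (yz j)   = y j , z j

tree : (n : ℕ) (d : Fin n → ℕ) (p : Fin n → ℕ → ℕ) (f : Fin n → ℕ) → WGraph
tree n d p f = record
  { V = TV n f ; E = TE n f ; ends = TEnds n f ; wv = w ; we = λ _ → 1 }
  where
    L = maxFin n d
    w : TV n f → ℕ
    w r       = 2 * L
    w (y _)   = 3 * L
    w (z _)   = 1
    w (u j i) = 2 * L ∸ toℕ i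
    w (v j i) = p j (toℕ i)

module Submission where

-- Contamination is encoded by one height per branch of T: branch 0 is
-- r y₀ z₀, branch j+1 is the path P_j together with r u_j^{f_j},
-- v_j^0 y_{j+1} and y_{j+1} z_{j+1}.  The edges of a branch are ranked from
-- the leaf z upwards, and an edge is contaminated iff its rank is below the
-- height of its branch, so every branch is cleared top-down.  Such states
-- are automatically connected (through r y₀), and they are closed under
-- recontamination as soon as every frontier vertex (where a branch passes
-- from clear to contaminated) holds its weight and r either holds 2L
-- searchers or has uniformly clear or uniformly contaminated edges.
--
-- The strategy: (0) clear r y₀ z₀ with all 4L searchers; (1) for the tasks
-- k ≠ ℓ in order of their start times (ℓ = a task starting first), a team of
-- 2L − G searchers (G = searchers left behind so far) clears P_k top-down,
-- leaves p_k(m) ≤ p_k(s_k) of them on v_k^m (m = min(s_k, f_k − 1)) as a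
-- guard and returns to r, while 2L searchers stay on r; feasibility of the
-- schedule gives G + C_ℓ ≤ C_k ≤ L; (2) P_ℓ is treated the same way by all
-- remaining searchers, which clears every edge at r; (3) a team of 3L
-- searchers finishes the branches one at a time: it walks to the guard,
-- absorbs it, clears the branch down to z and returns.

open import Defs
open import Data.Nat
  using (ℕ; zero; suc; _+_; _*_; _∸_; _≤_; _<_; _≤?_; _<?_; z≤n; s≤s; _⊓_)
open import Data.Nat.Properties
open import Data.Bool using (Bool; true; false; not)
open import Data.Product using (Σ; _×_; _,_; proj₁; proj₂)
open import Data.Sum using (_⊎_; inj₁; inj₂)
open import Data.Empty using (⊥; ⊥-elim)
open import Relation.Nullary using (¬_; Dec; yes; no)
open import Relation.Nullary.Decidable using (_×-dec_; ¬?)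
open import Relation.Binary.Definitions using (DecidableEquality)
open import Relation.Binary.PropositionalEquality
open import Data.Fin using (Fin; toℕ; fromℕ; inject₁) renaming (zero to fz; suc to fs)
import Data.Fin as F
import Data.Fin.Properties as FP

-- A move is determined by the slide and by the new contamination
-- flags; it is legal as soon as the new flags are the old ones with the
-- traversed edge cleared and are closed under recontamination.
module Sliding (G : WGraph) (_≟_ : DecidableEquality (WGraph.V G)) where
  open WGraph G

  slide : (V → ℕ) → V → V → ℕ → V → ℕ
  slide σ a b j c with c ≟ a | c ≟ b
  ... | yes _ | _     = σ c ∸ j
  ... | no _  | yes _ = σ c + j
  ... | no _  | no _  = σ c

  slide-from : ∀ σ a b j → slide σ a b j a ≡ σ a ∸ j
  slide-from σ a b j with a ≟ a
  ... | yes _ = refl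
  ... | no ne = ⊥-elim (ne refl)

  slide-to : ∀ σ a b j → a ≢ b → slide σ a b j b ≡ σ b + j
  slide-to σ a b j ne with b ≟ a | b ≟ b
  ... | yes eq | _     = ⊥-elim (ne (sym eq))
  ... | no _   | yes _ = refl
  ... | no _   | no n  = ⊥-elim (n refl)

  slide-elsewhere : ∀ σ a b j c → c ≢ a → c ≢ b → slide σ a b j c ≡ σ c
  slide-elsewhere σ a b j c n1 n2 with c ≟ a | c ≟ b
  ... | yes e | _     = ⊥-elim (n1 e)
  ... | no _  | yes e = ⊥-elim (n2 e)
  ... | no _  | no _  = refl

  slide-keeps : ∀ σ a b j c → c ≢ a → σ c ≤ slide σ a b j c
  slide-keeps σ a b j c n1 with c ≟ a | c ≟ b
  ... | yes e | _     = ⊥-elim (n1 e)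
  ... | no _  | yes e = m≤m+n _ _
  ... | no _  | no _  = ≤-refl

  slide-delivers : ∀ σ a b j → a ≢ b → j ≤ slide σ a b j b
  slide-delivers σ a b j ne rewrite slide-to σ a b j ne = m≤n+m j (σ b)

  slide-leaves : ∀ σ a b {g q} → q ≤ g → g ≤ σ a → q ≤ slide σ a b (g ∸ q) a
  slide-leaves σ a b {g} {q} qg ga =
    subst (q ≤_) (sym (slide-from σ a b (g ∸ q)))
      (≤-trans (≤-reflexive (sym (m∸[m∸n]≡n qg))) (∸-monoˡ-≤ (g ∸ q) ga))

  onlyAt : V → ℕ → V → ℕ
  onlyAt v₀ k c with c ≟ v₀
  ... | yes _ = k
  ... | no _  = 0

  onlyAt-here : ∀ v₀ k → onlyAt v₀ k v₀ ≡ k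
  onlyAt-here v₀ k with v₀ ≟ v₀
  ... | yes _ = refl
  ... | no ne = ⊥-elim (ne refl)

  onlyAt-elsewhere : ∀ v₀ k c → c ≢ v₀ → onlyAt v₀ k c ≡ 0
  onlyAt-elsewhere v₀ k c ne with c ≟ v₀
  ... | yes e = ⊥-elim (ne e)
  ... | no _  = refl

  RecontClosed : (V → ℕ) → (E → Bool) → Set
  RecontClosed σ κ = ∀ {e e' a} → κ e ≡ true → Incident G a e → Incident G a e' →
                     σ a < wv a → κ e' ≡ true

  slideStep : ∀ σ κ κ' e dir j a b →
    proj₁ (oriented G dir e) ≡ a → proj₂ (oriented G dir e) ≡ b →
    1 ≤ j → j ≤ σ a → a ≢ b → we e ≤ j →
    κ' e ≡ false → (∀ e' → e' ≢ e → κ' e' ≡ κ e') →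
    RecontClosed (slide σ a b j) κ' →
    Step G ⟨ σ , κ ⟩ ⟨ slide σ a b j , κ' ⟩
  slideStep σ κ κ' e dir j _ _ refl refl j1 ja ab wj cleared same closed = record
    { e = e ; dir = dir ; j = j ; j≥1 = j1 ; enough = ja
    ; weight = λ _ → wj
    ; leave = trans (cong (_+ j) (slide-from σ a b j)) (m∸n+n≡m ja)
    ; arrive = slide-to σ a b j ab
    ; others = λ c n1 n2 → slide-elsewhere σ a b j c n1 n2
    ; contam = λ e' k → base (survivor e' k)
    ; contam⁻¹ = λ e' rc → closure rc }
    where
    a : V
    a = proj₁ (oriented G dir e)
    b : V
    b = proj₂ (oriented G dir e)
    survivor : ∀ e' → κ' e' ≡ true → (κ e' ≡ true) × (e' ≢ e)
    survivor e' k = trans (sym (same e' e'≢e)) k , e'≢e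
      where
      e'≢e : e' ≢ e
      e'≢e refl with trans (sym cleared) k
      ... | ()
    closure : ∀ {e'} → Recont G (slide σ a b j) (λ e'' → (κ e'' ≡ true) × (e'' ≢ e)) e' →
              κ' e' ≡ true
    closure (base (k , ne))        = trans (same _ ne) k
    closure (spread rc i1 i2 lt)  = closed (closure rc) i1 i2 lt

  reverse-from : ∀ dir e → proj₁ (oriented G (not dir) e) ≡ proj₂ (oriented G dir e)
  reverse-from true e = refl
  reverse-from false e = refl

  reverse-to : ∀ dir e → proj₂ (oriented G (not dir) e) ≡ proj₁ (oriented G dir e)
  reverse-to true e = refl
  reverse-to false e = refl

  linked-trans : ∀ {κ a b c} → Linked G κ a b → Linked G κ b c → Linked G κ a c
  linked-trans p here             = p
  linked-trans p (next q i1 i2 k) = next (linked-trans p q) i1 i2 k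

  linked-end : ∀ {κ a b} → κ a ≡ false → Linked G κ a b → κ b ≡ false
  linked-end ka here             = ka
  linked-end ka (next _ _ _ k)   = k

  linked-sym : ∀ {κ a b} → κ a ≡ false → Linked G κ a b → Linked G κ b a
  linked-sym ka here             = here
  linked-sym ka (next q i1 i2 k) =
    linked-trans (next here i2 i1 (linked-end ka q)) (linked-sym ka q)

  connectedVia : ∀ {κ} c → κ c ≡ false → (∀ e → κ e ≡ false → Linked G κ c e) →
                 ClearConnected G κ
  connectedVia c kc h e1 e2 k1 k2 = linked-trans (linked-sym kc (h e1 k1)) (h e2 k2)

double-suc : ∀ m → 2 * suc m ≡ 2 + 2 * m
double-suc m = cong suc (+-suc m (m + 0))

double-shift : ∀ {k i} → k ≡ suc i → 2 + 2 * k ≡ 4 + 2 * i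
double-shift {i = i} refl = cong (2 +_) (double-suc i)

double-mono : ∀ {a b} → a ≤ b → 2 * a ≤ 2 * b
double-mono q = *-monoʳ-≤ 2 q

double-injective : ∀ {a b} → 2 * a ≡ 2 * b → a ≡ b
double-injective {a} {b} eq = *-cancelˡ-≡ a b 2 eq

squeeze₂ : ∀ {a H} → a < H → H ≤ 2 + a → (H ≡ suc a) ⊎ (H ≡ 2 + a)
squeeze₂ {a} {H} p q with m≤n⇒m<n∨m≡n q
... | inj₂ e        = inj₂ e
... | inj₁ (s≤s q') = inj₁ (≤-antisym q' p)

empty-gap : ∀ {a b H : ℕ} → a < H → H ≤ b → b ≤ a → ⊥
empty-gap p q w = <⇒≱ (≤-trans p q) w

positive-double : ∀ {a} → 1 ≤ a → 0 < 2 * a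
positive-double q = ≤-trans (s≤s z≤n) (*-monoʳ-≤ 2 q)

module TreeM (n : ℕ) (d : Fin n → ℕ) (p : Fin n → ℕ → ℕ) (f : Fin n → ℕ) where
  L : ℕ
  L = maxFin n d
  G : WGraph
  G = tree n d p f
  V : Set
  V = TV n f
  E : Set
  E = TE n f
  open WGraph G using (wv)

  _≟V_ : DecidableEquality V
  r ≟V r = yes refl
  r ≟V y _ = no λ ()
  r ≟V z _ = no λ ()
  r ≟V u _ _ = no λ ()
  r ≟V v _ _ = no λ ()
  y _ ≟V r = no λ ()
  y a ≟V y b with a FP.≟ b
  ... | yes refl = yes refl
  ... | no ne = no λ { refl → ne refl }
  y _ ≟V z _ = no λ ()
  y _ ≟V u _ _ = no λ ()
  y _ ≟V v _ _ = no λ ()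
  z _ ≟V r = no λ ()
  z _ ≟V y _ = no λ ()
  z a ≟V z b with a FP.≟ b
  ... | yes refl = yes refl
  ... | no ne = no λ { refl → ne refl }
  z _ ≟V u _ _ = no λ ()
  z _ ≟V v _ _ = no λ ()
  u _ _ ≟V r = no λ ()
  u _ _ ≟V y _ = no λ ()
  u _ _ ≟V z _ = no λ ()
  u j i ≟V u j' i' with j FP.≟ j'
  ... | no ne = no λ { refl → ne refl }
  ... | yes refl with i FP.≟ i'
  ...   | yes refl = yes refl
  ...   | no ne = no λ { refl → ne refl }
  u _ _ ≟V v _ _ = no λ ()
  v _ _ ≟V r = no λ ()
  v _ _ ≟V y _ = no λ ()
  v _ _ ≟V z _ = no λ ()
  v _ _ ≟V u _ _ = no λ ()
  v j i ≟V v j' i' with j FP.≟ j'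
  ... | no ne = no λ { refl → ne refl }
  ... | yes refl with i FP.≟ i'
  ...   | yes refl = yes refl
  ...   | no ne = no λ { refl → ne refl }

  open Sliding G _≟V_ public

  -- At x e: x is an endpoint of e, with the index arithmetic of the path
  -- edges exposed (so that case analyses never meet Fin-casts)
  data At : V → E → Set where
    uvU : ∀ j i → At (u j i) (uv j i)
    uvV : ∀ j i → At (v j i) (uv j i)
    vuV : ∀ j i k → toℕ k ≡ toℕ i → At (v j k) (vu j i)
    vuU : ∀ j i k → toℕ k ≡ suc (toℕ i) → At (u j k) (vu j i)
    ryR : At r ry₀
    ryY : At (y fz) ry₀
    ruR : ∀ j → At r (ru j)
    ruU : ∀ j k → toℕ k ≡ f j → At (u j k) (ru j)
    vyV : ∀ j k → toℕ k ≡ 0 → At (v j k) (vy j)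
    vyY : ∀ j → At (y (fs j)) (vy j)
    yzY : ∀ k → At (y k) (yz k)
    yzZ : ∀ k → At (z k) (yz k)

  atView : ∀ {x e} → Incident G x e → At x e
  atView {e = uv j i} (inj₁ refl) = uvU j i
  atView {e = uv j i} (inj₂ refl) = uvV j i
  atView {e = vu j i} (inj₁ refl) = vuV j i (inject₁ i) (FP.toℕ-inject₁ i)
  atView {e = vu j i} (inj₂ refl) = vuU j i (fs i) refl
  atView {e = ry₀} (inj₁ refl) = ryR
  atView {e = ry₀} (inj₂ refl) = ryY
  atView {e = ru j} (inj₁ refl) = ruR j
  atView {e = ru j} (inj₂ refl) = ruU j (fromℕ (f j)) (FP.toℕ-fromℕ _)
  atView {e = vy j} (inj₁ refl) = vyV j fz refl
  atView {e = vy j} (inj₂ refl) = vyY j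
  atView {e = yz k} (inj₁ refl) = yzY k
  atView {e = yz k} (inj₂ refl) = yzZ k

  atIncident : ∀ {x e} → At x e → Incident G x e
  atIncident (uvU j i) = inj₁ refl
  atIncident (uvV j i) = inj₂ refl
  atIncident (vuV j i k eq) =
    inj₁ (cong (v j) (FP.toℕ-injective (trans (FP.toℕ-inject₁ i) (sym eq))))
  atIncident (vuU j i k eq) = inj₂ (cong (u j) (FP.toℕ-injective (sym eq)))
  atIncident ryR = inj₁ refl
  atIncident ryY = inj₂ refl
  atIncident (ruR j) = inj₁ refl
  atIncident (ruU j k eq) =
    inj₂ (cong (u j) (FP.toℕ-injective (trans (FP.toℕ-fromℕ _) (sym eq))))
  atIncident (vyV j k eq) = inj₁ (cong (v j) (FP.toℕ-injective (sym eq)))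
  atIncident (vyY j) = inj₂ refl
  atIncident (yzY k) = inj₁ refl
  atIncident (yzZ k) = inj₂ refl

  -- Branches and ranks: the edges of branch fs j, from the leaf upwards,
  -- are y z, v^0 y, u^0 v^0, v^0 u^1, u^1 v^1, …, u^f v^f, u^f r with ranks
  -- 0, 1, 2, 3, …, 2f+2, 2f+3; branch fz consists of y₀ z₀ and r y₀.
  branch : E → Fin (suc n)
  branch (uv j _) = fs j
  branch (vu j _) = fs j
  branch ry₀ = fz
  branch (ru j) = fs j
  branch (vy j) = fs j
  branch (yz k) = k

  rank : E → ℕ
  rank (uv j i) = 2 + 2 * toℕ i
  rank (vu j i) = 3 + 2 * toℕ i
  rank ry₀ = 1
  rank (ru j) = 3 + 2 * f j
  rank (vy j) = 1
  rank (yz k) = 0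

  rank-injective : ∀ e e' → branch e' ≡ branch e → rank e' ≡ rank e → e' ≡ e
  rank-injective (uv j i) (uv j' i') b q with FP.suc-injective b
  ... | refl = cong (uv j) (FP.toℕ-injective (double-injective (suc-injective (suc-injective q))))
  rank-injective (uv j i) (vu j' i') b q =
    ⊥-elim (even≢odd (toℕ i) (toℕ i') (sym (suc-injective (suc-injective q))))
  rank-injective (uv j i) (ru j') b q =
    ⊥-elim (even≢odd (toℕ i) (f j') (sym (suc-injective (suc-injective q))))
  rank-injective (vu j i) (uv j' i') b q =
    ⊥-elim (even≢odd (toℕ i') (toℕ i) (suc-injective (suc-injective q)))
  rank-injective (vu j i) (vu j' i') b q with FP.suc-injective b
  ... | refl = cong (vu j) (FP.toℕ-injective (double-injective
                 (suc-injective (suc-injective (suc-injective q)))))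
  rank-injective (vu j i) (ru j') b q with FP.suc-injective b
  ... | refl = ⊥-elim (<⇒≢ (FP.toℕ<n i) (sym (double-injective
                 (suc-injective (suc-injective (suc-injective q))))))
  rank-injective (ru j) (uv j' i') b q =
    ⊥-elim (even≢odd (toℕ i') (f j) (suc-injective (suc-injective q)))
  rank-injective (ru j) (vu j' i') b q with FP.suc-injective b
  ... | refl = ⊥-elim (<⇒≢ (FP.toℕ<n i') (double-injective
                 (suc-injective (suc-injective (suc-injective q)))))
  rank-injective (ru j) (ru j') b q with FP.suc-injective b
  ... | refl = refl
  rank-injective ry₀ ry₀ b q = refl
  rank-injective (vy j) (vy j') b q with FP.suc-injective b
  ... | refl = refl
  rank-injective (yz k) (yz k') b q = cong yz b
  rank-injective (uv _ _) (vy _) b ()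
  rank-injective (uv _ _) (yz _) b ()
  rank-injective (uv _ _) ry₀ () q
  rank-injective (vu _ _) (vy _) b ()
  rank-injective (vu _ _) (yz _) b ()
  rank-injective (vu _ _) ry₀ () q
  rank-injective (ru _) (vy _) b ()
  rank-injective (ru _) (yz _) b ()
  rank-injective (ru _) ry₀ () q
  rank-injective ry₀ (yz _) b ()
  rank-injective ry₀ (uv _ _) () q
  rank-injective ry₀ (vu _ _) () q
  rank-injective ry₀ (ru _) () q
  rank-injective ry₀ (vy _) () q
  rank-injective (vy _) (uv _ _) b ()
  rank-injective (vy _) (vu _ _) b ()
  rank-injective (vy _) (ru _) b ()
  rank-injective (vy _) (yz _) b ()
  rank-injective (vy _) ry₀ () q
  rank-injective (yz _) (uv _ _) b ()
  rank-injective (yz _) (vu _ _) b ()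
  rank-injective (yz _) (ru _) b ()
  rank-injective (yz _) (vy _) b ()
  rank-injective (yz _) ry₀ b ()

  Heights : Set
  Heights = Fin (suc n) → ℕ

  -- a Dec as a Bool that only reduces once the decision is known
  decided : ∀ {A : Set} → Dec A → Bool
  decided (yes _) = true
  decided (no _)  = false

  contam : Heights → E → Bool
  contam h e = decided (rank e <? h (branch e))

  contam⇒below : ∀ h e → contam h e ≡ true → rank e < h (branch e)
  contam⇒below h e q with rank e <? h (branch e)
  ... | yes pr = pr
  contam⇒below h e () | no _

  clear⇒above : ∀ h e → contam h e ≡ false → h (branch e) ≤ rank e
  clear⇒above h e q with rank e <? h (branch e)
  clear⇒above h e () | yes _
  ... | no np = ≮⇒≥ np

  below⇒contam : ∀ h e → rank e < h (branch e) → contam h e ≡ true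
  below⇒contam h e pr with rank e <? h (branch e)
  ... | yes _ = refl
  ... | no np = ⊥-elim (np pr)

  above⇒clear : ∀ h e → h (branch e) ≤ rank e → contam h e ≡ false
  above⇒clear h e pr with rank e <? h (branch e)
  ... | yes q = ⊥-elim (<⇒≱ q pr)
  ... | no np = refl

  -- Front b H x: x is the frontier vertex of branch b at height H, i.e. the
  -- common endpoint of its edges of ranks H − 1 (contaminated) and H (clear)
  data Front : Fin (suc n) → ℕ → V → Set where
    fy0  : ∀ {H} → H ≡ 1 → Front fz H (y fz)
    ftop : ∀ {H} j k → toℕ k ≡ f j → H ≡ 3 + 2 * f j → Front (fs j) H (u j k)
    fu   : ∀ {H} j k → 1 ≤ toℕ k → H ≡ 2 + 2 * toℕ k → Front (fs j) H (u j k)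
    fv   : ∀ {H} j k → toℕ k < f j → H ≡ 3 + 2 * toℕ k → Front (fs j) H (v j k)
    fv0  : ∀ {H} j k → toℕ k ≡ 0 → H ≡ 2 → Front (fs j) H (v j k)
    fy   : ∀ {H} j → H ≡ 1 → Front (fs j) H (y (fs j))

  frontier-u : ∀ (h : Heights) {j k e e'} → At (u j k) e → At (u j k) e' →
               rank e < h (branch e) → h (branch e') ≤ rank e' →
               Front (branch e) (h (branch e)) (u j k)
  frontier-u h (uvU j k) (uvU .j .k) pr qr = ⊥-elim (empty-gap pr qr ≤-refl)
  frontier-u h (uvU j k) (vuU .j i .k eq) pr qr =
    ⊥-elim (empty-gap pr qr (≤-trans (n≤1+n _) (≤-reflexive (sym (double-shift eq)))))
  frontier-u h (uvU j k) (ruU .j .k eq) pr qr =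
    ftop j k eq (≤-antisym qr (subst (λ t → 2 + 2 * t < h (fs j)) eq pr))
  frontier-u h (vuU j i k eq) (uvU .j .k) pr qr =
    fu j k (subst (1 ≤_) (sym eq) (s≤s z≤n)) (≤-antisym qr (subst (_≤ h (fs j)) k≡ pr))
    where
    k≡ : 4 + 2 * toℕ i ≡ 2 + 2 * toℕ k
    k≡ = sym (double-shift eq)
  frontier-u h (vuU j i k eq) (vuU .j i' .k eq') pr qr =
    ⊥-elim (empty-gap pr qr (≤-reflexive (cong (λ t → 3 + 2 * t) (suc-injective (trans (sym eq') eq)))))
  frontier-u h (vuU j i k eq) (ruU .j .k eq') pr qr =
    top-or-below (squeeze₂ pr (subst (λ t → h (fs j) ≤ 3 + t) f≡ qr))
    where
    f≡ : 2 * f j ≡ 2 + 2 * toℕ i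
    f≡ = trans (cong (2 *_) (trans (sym eq') eq)) (double-suc (toℕ i))
    top-or-below : (h (fs j) ≡ 4 + 2 * toℕ i) ⊎ (h (fs j) ≡ 5 + 2 * toℕ i) →
                   Front (fs j) (h (fs j)) (u j k)
    top-or-below (inj₁ e) = fu j k (subst (1 ≤_) (sym eq) (s≤s z≤n)) (trans e (sym (double-shift eq)))
    top-or-below (inj₂ e) = ftop j k eq' (trans e (cong (3 +_) (sym f≡)))
  frontier-u h (ruU j k eq) (uvU .j .k) pr qr =
    ⊥-elim (empty-gap pr qr (≤-trans (+-monoʳ-≤ 2 (double-mono (FP.toℕ≤pred[n] k))) (n≤1+n _)))
  frontier-u h (ruU j k eq) (vuU .j i .k eq') pr qr =
    ⊥-elim (empty-gap pr qr (+-monoʳ-≤ 3 (double-mono (≤-trans (n≤1+n _)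
      (subst (_≤ f j) eq' (FP.toℕ≤pred[n] k))))))
  frontier-u h (ruU j k eq) (ruU .j .k eq') pr qr = ⊥-elim (empty-gap pr qr ≤-refl)

  frontier-v : ∀ (h : Heights) {j k e e'} → At (v j k) e → At (v j k) e' →
               rank e < h (branch e) → h (branch e') ≤ rank e' →
               Front (branch e) (h (branch e)) (v j k)
  frontier-v h (uvV j k) (uvV .j .k) pr qr = ⊥-elim (empty-gap pr qr ≤-refl)
  frontier-v h (uvV j k) (vuV .j i .k eq) pr qr =
    fv j k (subst (_< f j) (sym eq) (FP.toℕ<n i))
      (≤-antisym (subst (λ t → h (fs j) ≤ 3 + 2 * t) (sym eq) qr) pr)
  frontier-v h (uvV j k) (vyV .j .k eq) pr qr = ⊥-elim (empty-gap pr qr (s≤s z≤n))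
  frontier-v h (vuV j i k eq) (uvV .j .k) pr qr =
    ⊥-elim (empty-gap pr qr (subst (λ t → 2 + 2 * t ≤ 3 + 2 * toℕ i) (sym eq) (n≤1+n _)))
  frontier-v h (vuV j i k eq) (vuV .j i' .k eq') pr qr =
    ⊥-elim (empty-gap pr qr (≤-reflexive (cong (λ t → 3 + 2 * t) (trans (sym eq') eq))))
  frontier-v h (vuV j i k eq) (vyV .j .k eq') pr qr = ⊥-elim (empty-gap pr qr (s≤s z≤n))
  frontier-v h (vyV j k eq) (uvV .j .k) pr qr =
    fv0 j k eq (≤-antisym (subst (λ t → h (fs j) ≤ 2 + 2 * t) eq qr) pr)
  frontier-v h (vyV j k eq) (vuV .j i .k eq') pr qr
    with squeeze₂ pr (subst (λ t → h (fs j) ≤ 3 + 2 * t) (trans (sym eq') eq) qr)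
  ... | inj₁ e = fv0 j k eq e
  ... | inj₂ e = fv j k (subst (_< f j) (sym eq') (FP.toℕ<n i))
                   (trans e (cong (λ t → 3 + 2 * t) (sym eq)))
  frontier-v h (vyV j k eq) (vyV .j .k eq') pr qr = ⊥-elim (empty-gap pr qr ≤-refl)

  frontier : ∀ (h : Heights) {x e e'} → At x e → At x e' →
             rank e < h (branch e) → h (branch e') ≤ rank e' →
             (x ≡ r) ⊎ Front (branch e) (h (branch e)) x
  frontier h ryR _ _ _ = inj₁ refl
  frontier h (ruR j) _ _ _ = inj₁ refl
  frontier h a@(uvU _ _) a' pr qr = inj₂ (frontier-u h a a' pr qr)
  frontier h a@(vuU _ _ _ _) a' pr qr = inj₂ (frontier-u h a a' pr qr)
  frontier h a@(ruU _ _ _) a' pr qr = inj₂ (frontier-u h a a' pr qr)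
  frontier h a@(uvV _ _) a' pr qr = inj₂ (frontier-v h a a' pr qr)
  frontier h a@(vuV _ _ _ _) a' pr qr = inj₂ (frontier-v h a a' pr qr)
  frontier h a@(vyV _ _ _) a' pr qr = inj₂ (frontier-v h a a' pr qr)
  frontier h ryY ryY pr qr = ⊥-elim (empty-gap pr qr ≤-refl)
  frontier h ryY (yzY .fz) pr qr = ⊥-elim (empty-gap pr qr z≤n)
  frontier h (yzY .fz) ryY pr qr = inj₂ (fy0 (≤-antisym qr pr))
  frontier h (yzY k) (yzY .k) pr qr = ⊥-elim (empty-gap pr qr ≤-refl)
  frontier h (vyY j) (vyY .j) pr qr = ⊥-elim (empty-gap pr qr ≤-refl)
  frontier h (vyY j) (yzY .(fs j)) pr qr = ⊥-elim (empty-gap pr qr z≤n)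
  frontier h (yzY .(fs j)) (vyY j) pr qr = inj₂ (fy j (≤-antisym qr pr))
  frontier h (yzZ k) (yzZ .k) pr qr = ⊥-elim (empty-gap pr qr ≤-refl)

  Guarded : (V → ℕ) → Heights → Set
  Guarded σ h = ∀ {b x} → Front b (h b) x → wv x ≤ σ x

  RootSafe : (V → ℕ) → Heights → Set
  RootSafe σ h = (2 * L ≤ σ r) ⊎ ((∀ {e} → At r e → contam h e ≡ false) ⊎
                                  (∀ {e} → At r e → contam h e ≡ true))

  guarded⇒closed : ∀ σ h → Guarded σ h → RootSafe σ h → RecontClosed σ (contam h)
  guarded⇒closed σ h guarded safe {e} {e'} {x} ke i1 i2 lt with contam h e' in eq
  ... | true = refl
  ... | false with frontier h (atView {x} {e} i1) (atView {x} {e'} i2) (contam⇒below h e ke) (clear⇒above h e' eq)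
  ...   | inj₂ fr = ⊥-elim (<⇒≱ lt (guarded fr))
  ...   | inj₁ refl = ⊥-elim (unsafe safe)
    where
    unsafe : RootSafe σ h → ⊥
    unsafe (inj₁ q) = <⇒≱ lt q
    unsafe (inj₂ (inj₁ allClear)) with trans (sym ke) (allClear (atView {x} {e} i1))
    ... | ()
    unsafe (inj₂ (inj₂ allContam)) with trans (sym (allContam (atView {x} {e'} i2))) eq
    ... | ()

  -- With branch fz clear, every clear edge is linked to r y₀: the clear
  -- part of a branch is an initial segment of the path from r.
  module Connectivity (h : Heights) (h0 : h fz ≡ 0) where
    K : E → Bool
    K = contam h

    ry-clear : K ry₀ ≡ false
    ry-clear = above⇒clear h ry₀ (subst (_≤ 1) (sym h0) z≤n)

    linkRU : ∀ j → h (fs j) ≤ 3 + 2 * f j → Linked G K ry₀ (ru j)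
    linkRU j q = next here (inj₁ refl) (inj₁ refl) (above⇒clear h (ru j) q)

    -- induction on the distance m from the top of the path
    mutual
      linkUV : ∀ j (i : Fin (suc (f j))) (m : ℕ) → m + toℕ i ≡ f j →
               h (fs j) ≤ 2 + 2 * toℕ i → Linked G K ry₀ (uv j i)
      linkUV j i zero eq q =
        next (linkRU j (≤-trans q (+-monoʳ-≤ 2 (≤-trans (double-mono (≤-reflexive eq)) (n≤1+n _)))))
             (atIncident (ruU j i eq)) (inj₁ refl) (above⇒clear h (uv j i) q)
      linkUV j i (suc m) eq q =
        next (linkVU j i' m eq' (≤-trans q (≤-trans (n≤1+n _) (≤-reflexive (cong (λ t → 3 + 2 * t) ti')))))
             (atIncident (vuV j i' i ti')) (inj₂ refl) (above⇒clear h (uv j i) q)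
        where
        lt : toℕ i < f j
        lt = subst (toℕ i <_) eq (s≤s (m≤n+m (toℕ i) m))
        i' : Fin (f j)
        i' = F.fromℕ< lt
        ti' : toℕ i ≡ toℕ i'
        ti' = sym (FP.toℕ-fromℕ< lt)
        eq' : m + suc (toℕ i') ≡ f j
        eq' = trans (cong (λ t → m + suc t) (sym ti')) (trans (+-suc m (toℕ i)) eq)

      linkVU : ∀ j (i : Fin (f j)) (m : ℕ) → m + suc (toℕ i) ≡ f j →
               h (fs j) ≤ 3 + 2 * toℕ i → Linked G K ry₀ (vu j i)
      linkVU j i m eq q =
        next (linkUV j (fs i) m eq (≤-trans q (≤-trans (n≤1+n _)
               (≤-reflexive (cong (2 +_) (sym (double-suc (toℕ i))))))))
             (inj₁ refl) (inj₂ refl) (above⇒clear h (vu j i) q)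

    linkToRoot : ∀ e → K e ≡ false → Linked G K ry₀ e
    linkToRoot (uv j i) k =
      linkUV j i (f j ∸ toℕ i) (m∸n+n≡m (FP.toℕ≤pred[n] i)) (clear⇒above h (uv j i) k)
    linkToRoot (vu j i) k =
      linkVU j i (f j ∸ suc (toℕ i)) (m∸n+n≡m (FP.toℕ<n i)) (clear⇒above h (vu j i) k)
    linkToRoot ry₀ k = here
    linkToRoot (ru j) k = linkRU j (clear⇒above h (ru j) k)
    linkToRoot (vy j) k =
      next (linkUV j fz (f j) (+-identityʳ (f j)) (≤-trans (clear⇒above h (vy j) k) (n≤1+n _)))
           (inj₂ refl) (inj₁ refl) k
    linkToRoot (yz fz) k = next here (inj₂ refl) (inj₁ refl) k
    linkToRoot (yz (fs j)) k =
      next (linkToRoot (vy j) (above⇒clear h (vy j) (≤-trans (clear⇒above h (yz (fs j)) k) z≤n)))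
           (inj₂ refl) (inj₁ refl) k

    connected : ClearConnected G K
    connected = connectedVia ry₀ ry-clear linkToRoot

  setH : Heights → Fin (suc n) → ℕ → Heights
  setH h b H b' with b' FP.≟ b
  ... | yes _ = H
  ... | no _  = h b'

  setH-same : ∀ h b H → setH h b H b ≡ H
  setH-same h b H with b FP.≟ b
  ... | yes _ = refl
  ... | no ne = ⊥-elim (ne refl)

  setH-other : ∀ h b H b' → b' ≢ b → setH h b H b' ≡ h b'
  setH-other h b H b' ne with b' FP.≟ b
  ... | yes e = ⊥-elim (ne e)
  ... | no _  = refl

  lower-clears : ∀ h e b → branch e ≡ b → contam (setH h b (rank e)) e ≡ false
  lower-clears h e b refl = above⇒clear (setH h (branch e) (rank e)) e
                              (≤-reflexive (setH-same h (branch e) (rank e)))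

  lower-keeps : ∀ h e b → branch e ≡ b → h b ≡ suc (rank e) →
                ∀ e' → e' ≢ e → contam (setH h b (rank e)) e' ≡ contam h e'
  lower-keeps h e b refl hb e' ne = bySameBranch (branch e' FP.≟ branch e)
    where
    h' : Heights
    h' = setH h (branch e) (rank e)
    bySameBranch : Dec (branch e' ≡ branch e) → contam h' e' ≡ contam h e'
    bySameBranch (no nb) =
      cong (λ t → decided (rank e' <? t)) (setH-other h (branch e) (rank e) (branch e') nb)
    bySameBranch (yes eb) = byRank (rank e' <? h (branch e'))
      where
      h'b : h' (branch e') ≡ rank e
      h'b = trans (cong h' eb) (setH-same h (branch e) (rank e))
      hb' : h (branch e') ≡ suc (rank e)
      hb' = trans (cong h eb) hb
      -- e' ≠ e has a different rank, so it stays on its side of the height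
      byRank : Dec (rank e' < h (branch e')) → contam h' e' ≡ contam h e'
      byRank (yes lt) = trans (below⇒contam h' e' (still-below (m≤n⇒m<n∨m≡n (≤-pred (subst (rank e' <_) hb' lt)))))
                              (sym (below⇒contam h e' lt))
        where
        still-below : (rank e' < rank e) ⊎ (rank e' ≡ rank e) → rank e' < h' (branch e')
        still-below (inj₁ l) = subst (rank e' <_) (sym h'b) l
        still-below (inj₂ q) = ⊥-elim (ne (rank-injective e e' eb q))
      byRank (no nl) =
        trans (above⇒clear h' e' (≤-trans (≤-reflexive h'b) (≤-trans (n≤1+n _) (≤-trans (≤-reflexive (sym hb')) (≮⇒≥ nl)))))
              (sym (above⇒clear h e' (≮⇒≥ nl)))

  Strat : (V → ℕ) → Heights → Set
  Strat σ h = StrategyFrom G ⟨ σ , contam h ⟩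

  move : ∀ σ h h' e dir j a b →
       proj₁ (oriented G dir e) ≡ a → proj₂ (oriented G dir e) ≡ b →
       1 ≤ j → j ≤ σ a → a ≢ b →
       contam h' e ≡ false → (∀ e' → e' ≢ e → contam h' e' ≡ contam h e') →
       h' fz ≡ 0 → Guarded (slide σ a b j) h' → RootSafe (slide σ a b j) h' →
       Strat (slide σ a b j) h' → Strat σ h
  move σ h h' e dir j a b ea eb j1 ja ab cleared same h0 guarded safe k =
    step (slideStep σ (contam h) (contam h') e dir j a b ea eb j1 ja ab j1 cleared same
           (λ {e₁} {e₂} {x} → guarded⇒closed _ h' guarded safe {e₁} {e₂} {x}))
         (Connectivity.connected h' h0) k

  moveOnClear : ∀ σ h e dir j a b →
       proj₁ (oriented G dir e) ≡ a → proj₂ (oriented G dir e) ≡ b →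
       1 ≤ j → j ≤ σ a → a ≢ b →
       contam h e ≡ false → h fz ≡ 0 →
       Guarded (slide σ a b j) h → RootSafe (slide σ a b j) h →
       Strat (slide σ a b j) h → Strat σ h
  moveOnClear σ h e dir j a b ea eb j1 ja ab ke h0 guarded safe k =
    move σ h h e dir j a b ea eb j1 ja ab ke (λ _ _ → refl) h0 guarded safe k

  uAt : (j : Fin n) (m : ℕ) → .(m < suc (f j)) → V
  uAt j m lt = u j (F.fromℕ< lt)
  vAt : (j : Fin n) (m : ℕ) → .(m < suc (f j)) → V
  vAt j m lt = v j (F.fromℕ< lt)

  u≡uAt : ∀ j (k : Fin (suc (f j))) {m} .(lt : m < suc (f j)) → toℕ k ≡ m → u j k ≡ uAt j m lt
  u≡uAt j k lt eq = cong (u j) (FP.toℕ-injective (trans eq (sym (FP.toℕ-fromℕ< lt))))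
  v≡vAt : ∀ j (k : Fin (suc (f j))) {m} .(lt : m < suc (f j)) → toℕ k ≡ m → v j k ≡ vAt j m lt
  v≡vAt j k lt eq = cong (v j) (FP.toℕ-injective (trans eq (sym (FP.toℕ-fromℕ< lt))))

  vAt-injective : ∀ {j t t'} .{l1 : t < suc (f j)} .{l2 : t' < suc (f j)} →
                  vAt j t l1 ≡ vAt j t' l2 → t ≡ t'
  vAt-injective {j} {t} {t'} {l1} {l2} e =
    trans (sym (FP.toℕ-fromℕ< l1)) (trans (cong toℕ (index e)) (FP.toℕ-fromℕ< l2))
    where
    index : ∀ {a b : Fin (suc (f j))} → v j a ≡ v j b → a ≡ b
    index refl = refl

  front-top : ∀ {j H x} → H ≡ 3 + 2 * f j → Front (fs j) H x → x ≡ uAt j (f j) ≤-refl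
  front-top refl (ftop j k eqk _) = u≡uAt j k _ eqk
  front-top refl (fu j k _ eqH) =
    ⊥-elim (even≢odd (toℕ k) (f j) (suc-injective (suc-injective (sym eqH))))
  front-top refl (fv j k lt eqH) =
    ⊥-elim (<⇒≢ lt (sym (double-injective (suc-injective (suc-injective (suc-injective eqH))))))
  front-top refl (fv0 j k _ ())
  front-top refl (fy j ())

  front-u : ∀ {j H x m} → 1 ≤ m → (le : m ≤ f j) → H ≡ 2 + 2 * m → Front (fs j) H x →
            x ≡ uAt j m (s≤s le)
  front-u {m = m} m1 le refl (ftop j k eqk eqH) =
    ⊥-elim (even≢odd m (f j) (suc-injective (suc-injective eqH)))
  front-u m1 le refl (fu j k _ eqH) =
    u≡uAt j k _ (double-injective (suc-injective (suc-injective (sym eqH))))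
  front-u {m = m} m1 le refl (fv j k _ eqH) =
    ⊥-elim (even≢odd m (toℕ k) (suc-injective (suc-injective eqH)))
  front-u m1 le refl (fv0 j k _ eqH) =
    ⊥-elim (<⇒≢ (positive-double m1) (sym (suc-injective (suc-injective eqH))))
  front-u m1 le refl (fy j ())

  front-v : ∀ {j H x m} → (lt : m < f j) → H ≡ 3 + 2 * m → Front (fs j) H x →
            x ≡ vAt j m (≤-trans lt (n≤1+n _))
  front-v lt refl (ftop j k eqk eqH) =
    ⊥-elim (<⇒≢ lt (double-injective (suc-injective (suc-injective (suc-injective eqH)))))
  front-v {m = m} lt refl (fu j k _ eqH) =
    ⊥-elim (even≢odd (toℕ k) m (sym (suc-injective (suc-injective eqH))))
  front-v lt refl (fv j k _ eqH) =
    v≡vAt j k _ (double-injective (suc-injective (suc-injective (suc-injective (sym eqH)))))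
  front-v lt refl (fv0 j k _ ())
  front-v lt refl (fy j ())

  front-v0 : ∀ {j H x} → H ≡ 2 → Front (fs j) H x → x ≡ vAt j 0 (s≤s z≤n)
  front-v0 refl (ftop j k eqk ())
  front-v0 refl (fu j k k1 eqH) =
    ⊥-elim (<⇒≢ (positive-double k1) (suc-injective (suc-injective eqH)))
  front-v0 refl (fv j k _ ())
  front-v0 refl (fv0 j k k0 _) = v≡vAt j k (s≤s z≤n) k0
  front-v0 refl (fy j ())

  front-y : ∀ {j H x} → H ≡ 1 → Front (fs j) H x → x ≡ y (fs j)
  front-y refl (ftop j k eqk ())
  front-y refl (fu j k k1 ())
  front-y refl (fv j k _ ())
  front-y refl (fv0 j k k0 ())
  front-y refl (fy j _) = refl

  front-cleared : ∀ {b H x} → H ≡ 0 → Front b H x → ⊥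
  front-cleared refl (fy0 ())
  front-cleared refl (ftop j k eqk ())
  front-cleared refl (fu j k k1 ())
  front-cleared refl (fv j k _ ())
  front-cleared refl (fv0 j k k0 ())
  front-cleared refl (fy j ())

  front-fresh : ∀ {j H x} → H ≡ 4 + 2 * f j → Front (fs j) H x → ⊥
  front-fresh refl (ftop j k eqk eqH) = 1+n≢n eqH
  front-fresh refl (fu j k _ eqH) =
    <⇒≱ (s≤s (FP.toℕ≤pred[n] k))
        (≤-reflexive (double-injective (trans (double-suc (f j)) (suc-injective (suc-injective eqH)))))
  front-fresh refl (fv j k lt eqH) =
    even≢odd (toℕ k) (f j) (sym (suc-injective (suc-injective (suc-injective eqH))))
  front-fresh refl (fv0 j k _ ())
  front-fresh refl (fy j ())

  branchOf : V → Fin (suc n)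
  branchOf r = fz
  branchOf (y k) = k
  branchOf (z k) = k
  branchOf (u j _) = fs j
  branchOf (v j _) = fs j

  front-branch : ∀ {b H x} → Front b H x → branchOf x ≡ b
  front-branch (fy0 _) = refl
  front-branch (ftop j k _ _) = refl
  front-branch (fu j k _ _) = refl
  front-branch (fv j k _ _) = refl
  front-branch (fv0 j k _ _) = refl
  front-branch (fy j _) = refl

  front-not-root : ∀ {b H x} → Front b H x → x ≢ r
  front-not-root (fy0 _) ()
  front-not-root (ftop j k _ _) ()
  front-not-root (fu j k _ _) ()
  front-not-root (fv j k _ _) ()
  front-not-root (fv0 j k _ _) ()
  front-not-root (fy j _) ()

  GuardedOff : (V → ℕ) → Heights → Fin n → Set
  GuardedOff σ h j = ∀ {b x} → Front b (h b) x → b ≢ fs j → wv x ≤ σ x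

  GuardedOn : (V → ℕ) → Heights → Fin n → Set
  GuardedOn σ h j = ∀ {x} → Front (fs j) (h (fs j)) x → wv x ≤ σ x

  RootInv : (V → ℕ) → Heights → Set
  RootInv σ h = (2 * L ≤ σ r) ⊎ (∀ k → h (fs k) ≤ 3 + 2 * f k)

  guarded-from : ∀ σ h j → GuardedOff σ h j → GuardedOn σ h j → Guarded σ h
  guarded-from σ h j off on {b} {x} fr with b FP.≟ fs j
  ... | yes refl = on fr
  ... | no ne = off fr ne

  rootSafe : ∀ σ h → h fz ≡ 0 → RootInv σ h → RootSafe σ h
  rootSafe σ h h0 (inj₁ q) = inj₁ q
  rootSafe σ h h0 (inj₂ q) =
    inj₂ (inj₁ λ { ryR → above⇒clear h ry₀ (subst (_≤ 1) (sym h0) z≤n)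
                 ; (ruR k) → above⇒clear h (ru k) (q k) })

  OnBranch : Fin n → V → Set
  OnBranch j a = (branchOf a ≡ fs j) ⊎ (a ≡ r)

  off-slide : ∀ σ h j a c t → OnBranch j a → GuardedOff σ h j → GuardedOff (slide σ a c t) h j
  off-slide σ h j a c t oa off {b} {x} fr ne = ≤-trans (off fr ne) (slide-keeps σ a c t x x≢a)
    where
    x≢a : x ≢ a
    x≢a e = case oa
      where
      case : OnBranch j a → ⊥
      case (inj₁ q) = ne (trans (sym (front-branch fr)) (trans (cong branchOf e) q))
      case (inj₂ q) = front-not-root fr (trans e q)

  off-setH : ∀ σ h j H → GuardedOff σ h j → GuardedOff σ (setH h (fs j) H) j
  off-setH σ h j H off {b} {x} fr ne = off (subst (λ t → Front b t x) (setH-other h (fs j) H b ne) fr) ne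

  on-setH : ∀ σ h j H → (∀ {x} → Front (fs j) H x → wv x ≤ σ x) → GuardedOn σ (setH h (fs j) H) j
  on-setH σ h j H c fr = c (subst (λ t → Front (fs j) t _) (setH-same h (fs j) H) fr)

  rootInv-slide : ∀ σ h a c t → a ≢ r → RootInv σ h → RootInv (slide σ a c t) h
  rootInv-slide σ h a c t ar (inj₁ q) = inj₁ (≤-trans q (slide-keeps σ a c t r (λ e → ar (sym e))))
  rootInv-slide σ h a c t ar (inj₂ q) = inj₂ q

  rootInv-setH : ∀ σ h j H → H ≤ 3 + 2 * f j → RootInv σ h → RootInv σ (setH h (fs j) H)
  rootInv-setH σ h j H hle (inj₁ q) = inj₁ q
  rootInv-setH σ h j H hle (inj₂ q) = inj₂ λ k → below k (fs k FP.≟ fs j)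
    where
    below : ∀ k → Dec (fs k ≡ fs j) → setH h (fs j) H (fs k) ≤ 3 + 2 * f k
    below k (yes e) with FP.suc-injective e
    ... | refl = ≤-trans (≤-reflexive (setH-same h (fs j) H)) hle
    below k (no ne) = ≤-trans (≤-reflexive (setH-other h (fs j) H (fs k) ne)) (q k)

  uvIdx : ∀ j t → t ≤ f j → Fin (suc (f j))
  uvIdx j t lt = F.fromℕ< (s≤s lt)
  vuIdx : ∀ j t → t < f j → Fin (f j)
  vuIdx j t lt = F.fromℕ< lt

  toℕ-uvIdx : ∀ j t (lt : t ≤ f j) → toℕ (uvIdx j t lt) ≡ t
  toℕ-uvIdx j t lt = FP.toℕ-fromℕ< (s≤s lt)
  toℕ-vuIdx : ∀ j t (lt : t < f j) → toℕ (vuIdx j t lt) ≡ t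
  toℕ-vuIdx j t lt = FP.toℕ-fromℕ< lt

  vu-lower : ∀ j t (lt : t < f j) → v j (inject₁ (vuIdx j t lt)) ≡ vAt j t (≤-trans lt (n≤1+n _))
  vu-lower j t lt = v≡vAt j _ _ (trans (FP.toℕ-inject₁ _) (toℕ-vuIdx j t lt))
  ru-top : ∀ j → u j (fromℕ (f j)) ≡ uAt j (f j) ≤-refl
  ru-top j = u≡uAt j _ _ (FP.toℕ-fromℕ _)

  weight-u : ∀ j t .(lt : t < suc (f j)) → wv (uAt j t lt) ≡ 2 * L ∸ t
  weight-u j t lt = cong (2 * L ∸_) (FP.toℕ-fromℕ< lt)
  weight-v : ∀ j t .(lt : t < suc (f j)) → wv (vAt j t lt) ≡ p j t
  weight-v j t lt = cong (p j) (FP.toℕ-fromℕ< lt)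

  record Inv (j : Fin n) (σ : V → ℕ) (h : Heights) : Set where
    field
      clearBase   : h fz ≡ 0
      guardOthers : GuardedOff σ h j
      guardOwn    : GuardedOn σ h j
      rootInv     : RootInv σ h
  open Inv public

  clearStep : ∀ j σ h e dir t a c →
    branch e ≡ fs j → proj₁ (oriented G dir e) ≡ a → proj₂ (oriented G dir e) ≡ c →
    1 ≤ t → t ≤ σ a → a ≢ c → OnBranch j a → h (fs j) ≡ suc (rank e) →
    Inv j σ h → RootInv (slide σ a c t) (setH h (fs j) (rank e)) →
    (∀ {x} → Front (fs j) (rank e) x → wv x ≤ slide σ a c t x) →
    (Inv j (slide σ a c t) (setH h (fs j) (rank e)) → Strat (slide σ a c t) (setH h (fs j) (rank e))) →
    Strat σ h
  clearStep j σ h e dir t a c eb ea ec t1 ta ac oa hb inv ri' own k =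
    move σ h h' e dir t a c ea ec t1 ta ac (lower-clears h e (fs j) eb) (lower-keeps h e (fs j) eb hb)
       (clearBase inv') (guarded-from σ' h' j (guardOthers inv') (guardOwn inv'))
       (rootSafe σ' h' (clearBase inv') ri') (k inv')
    where
    h' : Heights
    h' = setH h (fs j) (rank e)
    σ' : V → ℕ
    σ' = slide σ a c t
    inv' : Inv j σ' h'
    inv' = record
      { clearBase = trans (setH-other h (fs j) (rank e) fz (λ ())) (clearBase inv)
      ; guardOthers = off-setH σ' h j (rank e) (off-slide σ h j a c t oa (guardOthers inv))
      ; guardOwn = on-setH σ' h j (rank e) own
      ; rootInv = ri' }

  walkStep : ∀ j σ h e dir t a c →
    proj₁ (oriented G dir e) ≡ a → proj₂ (oriented G dir e) ≡ c →
    1 ≤ t → t ≤ σ a → a ≢ c → OnBranch j a → contam h e ≡ false →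
    Inv j σ h → RootInv (slide σ a c t) h →
    (∀ {x} → Front (fs j) (h (fs j)) x → x ≡ a → wv x ≤ slide σ a c t x) →
    (Inv j (slide σ a c t) h → Strat (slide σ a c t) h) →
    Strat σ h
  walkStep j σ h e dir t a c ea ec t1 ta ac oa ke inv ri' leaving k =
    moveOnClear σ h e dir t a c ea ec t1 ta ac ke (clearBase inv)
      (guarded-from σ' h j (guardOthers inv') (guardOwn inv')) (rootSafe σ' h (clearBase inv) ri') (k inv')
    where
    σ' : V → ℕ
    σ' = slide σ a c t
    own : GuardedOn σ' h j
    own {x} fr = bySource (x ≟V a)
      where
      bySource : Dec (x ≡ a) → wv x ≤ σ' x
      bySource (yes e) = leaving fr e
      bySource (no ne) = ≤-trans (guardOwn inv fr) (slide-keeps σ a c t x ne)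
    inv' : Inv j σ' h
    inv' = record { clearBase = clearBase inv ; guardOthers = off-slide σ h j a c t oa (guardOthers inv)
                  ; guardOwn = own ; rootInv = ri' }
  -- Manoeuvres of a team of searchers on the branch fs j, written in
  -- continuation-passing style: each one takes the continuation after it.
  module Branch (j : Fin n) where
    fj : ℕ
    fj = f j

    top : V
    top = uAt j fj ≤-refl
    u0 : V
    u0 = uAt j 0 (s≤s z≤n)
    v0 : V
    v0 = vAt j 0 (s≤s z≤n)
    yj : V
    yj = y (fs j)
    zj : V
    zj = z (fs j)
    fj≡1+ : 1 ≤ fj → fj ≡ suc (fj ∸ 1)
    fj≡1+ f1 = trans (sym (m∸n+n≡m f1)) (+-comm (fj ∸ 1) 1)
    below-top : ∀ {t} → t < fj → t < suc fj
    below-top lt = ≤-trans lt (n≤1+n _)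
    uAt-cong : ∀ {t t'} .{l : t < suc fj} .{l' : t' < suc fj} → t ≡ t' → uAt j t l ≡ uAt j t' l'
    uAt-cong refl = refl
    vAt-cong : ∀ {t t'} .{l : t < suc fj} .{l' : t' < suc fj} → t ≡ t' → vAt j t l ≡ vAt j t' l'
    vAt-cong refl = refl

    Unchanged : Heights → Heights → Set
    Unchanged h h₀ = ∀ b → b ≢ fs j → h b ≡ h₀ b

    Cont : Heights → ℕ → V → ℕ → ℕ → Set
    Cont h₀ H X g R = ∀ σ' h' → Inv j σ' h' → h' (fs j) ≡ H → Unchanged h' h₀ → g ≤ σ' X → R ≤ σ' r → Strat σ' h'
    ContHome : Heights → ℕ → ℕ → Set
    ContHome h₀ H R = ∀ σ' h' → Inv j σ' h' → h' (fs j) ≡ H → Unchanged h' h₀ → R ≤ σ' r → Strat σ' h'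
    cont-at : ∀ {h₀ H H' X g R} → H ≡ H' → Cont h₀ H' X g R → Cont h₀ H X g R
    cont-at refl k = k
    cont-v : ∀ {h₀ H g R t t'} .{l : t < suc fj} .{l' : t' < suc fj} → t ≡ t' → Cont h₀ H (vAt j t' l') g R → Cont h₀ H (vAt j t l) g R
    cont-v refl k = k
    unchanged-setH : ∀ h h₀ H → Unchanged h h₀ → Unchanged (setH h (fs j) H) h₀
    unchanged-setH h h₀ H s b ne = trans (setH-other h (fs j) H b ne) (s b ne)

    NotFront : Heights → V → Set
    NotFront h a = ∀ {x} → Front (fs j) (h (fs j)) x → x ≡ a → ⊥

    Leaves : (V → ℕ) → Heights → V → V → ℕ → Set
    Leaves σ h a c g = ∀ {x} → Front (fs j) (h (fs j)) x → x ≡ a → wv x ≤ slide σ a c g x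
    notFront⇒leaves : ∀ σ h a c g → NotFront h a → Leaves σ h a c g
    notFront⇒leaves σ h a c g nf fr e = ⊥-elim (nf fr e)

    arrival-guards : ∀ σ a c g → a ≢ c → wv c ≤ g → ∀ {x} → x ≡ c → wv x ≤ slide σ a c g x
    arrival-guards σ a c g ac wc refl = ≤-trans wc (slide-delivers σ a c g ac)

    walk : ∀ σ h h₀ H e dir a c g R →
      proj₁ (oriented G dir e) ≡ a → proj₂ (oriented G dir e) ≡ c → a ≢ c → OnBranch j a → a ≢ r →
      Inv j σ h → h (fs j) ≡ H → Unchanged h h₀ → 1 ≤ g → g ≤ σ a → R ≤ σ r → contam h e ≡ false →
      Leaves σ h a c g → Cont h₀ H c g R → Strat σ h
    walk σ h h₀ H e dir a c g R ea ec ac oa ar inv hH un g1 ga Rr ke leaving k =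
      walkStep j σ h e dir g a c ea ec g1 ga ac oa ke inv (rootInv-slide σ h a c g ar (rootInv inv)) leaving
        (λ inv' → k _ h inv' hH un (slide-delivers σ a c g ac) (≤-trans Rr (slide-keeps σ a c g r (λ q → ar (sym q)))))
    clear : ∀ σ h h₀ e dir a c g R →
      branch e ≡ fs j → proj₁ (oriented G dir e) ≡ a → proj₂ (oriented G dir e) ≡ c → a ≢ c → OnBranch j a → a ≢ r →
      Inv j σ h → h (fs j) ≡ suc (rank e) → Unchanged h h₀ → 1 ≤ g → g ≤ σ a → R ≤ σ r → rank e ≤ 3 + 2 * fj →
      (∀ {x} → Front (fs j) (rank e) x → wv x ≤ slide σ a c g x) →
      Cont h₀ (rank e) c g R → Strat σ h
    clear σ h h₀ e dir a c g R eb ea ec ac oa ar inv hb un g1 ga Rr rk newFront k =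
      clearStep j σ h e dir g a c eb ea ec g1 ga ac oa hb inv
        (rootInv-setH (slide σ a c g) h j (rank e) rk (rootInv-slide σ h a c g ar (rootInv inv))) newFront
        (λ inv' → k _ _ inv' (setH-same h (fs j) (rank e)) (unchanged-setH h h₀ (rank e) un)
                 (slide-delivers σ a c g ac) (≤-trans Rr (slide-keeps σ a c g r (λ q → ar (sym q)))))

    enter : ∀ σ h h₀ g R → Inv j σ h → h (fs j) ≡ 4 + 2 * fj → Unchanged h h₀ → 1 ≤ g → R + g ≤ σ r →
      2 * L ∸ fj ≤ g → ((2 * L ≤ R) ⊎ (∀ k → k ≢ j → h (fs k) ≤ 3 + 2 * f k)) →
      Cont h₀ (3 + 2 * fj) top g R → Strat σ h
    enter σ h h₀ g R inv hH un g1 Rg wt RA k =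
      clearStep j σ h (ru j) true g r top refl refl (ru-top j) g1 (≤-trans (m≤n+m g R) Rg) (λ ()) (inj₂ refl) hH inv ri' newFront
        (λ inv' → k _ _ inv' (setH-same h (fs j) _) (unchanged-setH h h₀ _ un) (slide-delivers σ r top g (λ ())) Rr')
      where
      σ' : V → ℕ
      σ' = slide σ r top g
      Rr' : R ≤ σ' r
      Rr' = subst (R ≤_) (sym (slide-from σ r top g)) (m+n≤o⇒m≤o∸n R Rg)
      ri' : RootInv σ' (setH h (fs j) (3 + 2 * fj))
      ri' = byRoot RA
        where
        allClear : (∀ k → k ≢ j → h (fs k) ≤ 3 + 2 * f k) → ∀ k → Dec (k ≡ j) →
                   setH h (fs j) (3 + 2 * fj) (fs k) ≤ 3 + 2 * f k
        allClear q k (yes refl) = ≤-reflexive (setH-same h (fs j) _)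
        allClear q k (no ne) = ≤-trans (≤-reflexive (setH-other h (fs j) _ (fs k) (λ e → ne (FP.suc-injective e)))) (q k ne)
        byRoot : ((2 * L ≤ R) ⊎ (∀ k → k ≢ j → h (fs k) ≤ 3 + 2 * f k)) → RootInv σ' (setH h (fs j) (3 + 2 * fj))
        byRoot (inj₁ q) = inj₁ (≤-trans q Rr')
        byRoot (inj₂ q) = inj₂ λ k → allClear q k (k FP.≟ j)
      newFront : ∀ {x} → Front (fs j) (3 + 2 * fj) x → wv x ≤ σ' x
      newFront fr = arrival-guards σ r top g (λ ()) (subst (_≤ g) (sym (weight-u j fj ≤-refl)) wt) (front-top refl fr)

    exitToRoot : ∀ σ h h₀ H g R → Inv j σ h → h (fs j) ≡ H → Unchanged h h₀ → 1 ≤ g →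
      g ≤ σ top → R ≤ σ r → H ≤ 3 + 2 * fj → NotFront h top →
      ContHome h₀ H (R + g) → Strat σ h
    exitToRoot σ h h₀ H g R inv hH un g1 ga Rr Hle nf k =
      walkStep j σ h (ru j) false g top r (ru-top j) refl g1 ga (λ ()) (inj₁ refl) ke inv
        (rootInv-slide σ h top r g (λ ()) (rootInv inv)) (notFront⇒leaves σ h top r g nf)
        (λ inv' → k _ h inv' hH un (subst (R + g ≤_) (sym (slide-to σ top r g (λ ()))) (+-monoˡ-≤ g Rr)))
      where
      ke : contam h (ru j) ≡ false
      ke = above⇒clear h (ru j) (≤-trans (≤-reflexive hH) Hle)

    entryFromRoot : ∀ σ h h₀ H g R → Inv j σ h → h (fs j) ≡ H → Unchanged h h₀ → 1 ≤ g →
      R + g ≤ σ r → H ≤ 3 + 2 * fj → (∀ k → h (fs k) ≤ 3 + 2 * f k) →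
      Cont h₀ H top g R → Strat σ h
    entryFromRoot σ h h₀ H g R inv hH un g1 Rg Hle allc k =
      walkStep j σ h (ru j) true g r top refl (ru-top j) g1 (≤-trans (m≤n+m g R) Rg) (λ ()) (inj₂ refl) ke inv
        (inj₂ allc) (λ fr e → ⊥-elim (front-not-root fr e))
        (λ inv' → k _ h inv' hH un (slide-delivers σ r top g (λ ())) (subst (R ≤_) (sym (slide-from σ r top g)) (m+n≤o⇒m≤o∸n R Rg)))
      where
      ke : contam h (ru j) ≡ false
      ke = above⇒clear h (ru j) (≤-trans (≤-reflexive hH) Hle)

    upUV : ∀ σ h h₀ H g R t (le : t ≤ fj) → Inv j σ h → h (fs j) ≡ H → Unchanged h h₀ → 1 ≤ g →
      g ≤ σ (uAt j t (s≤s le)) → R ≤ σ r → H ≤ 2 + 2 * t →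
      Leaves σ h (uAt j t (s≤s le)) (vAt j t (s≤s le)) g →
      Cont h₀ H (vAt j t (s≤s le)) g R → Strat σ h
    upUV σ h h₀ H g R t le inv hH un g1 ga Rr Hle leaving k =
      walk σ h h₀ H (uv j (uvIdx j t le)) true _ _ g R refl refl (λ ()) (inj₁ refl) (λ ())
        inv hH un g1 ga Rr ke leaving k
      where
      ke : contam h (uv j (uvIdx j t le)) ≡ false
      ke = above⇒clear h (uv j (uvIdx j t le)) (≤-trans (≤-reflexive hH) (≤-trans Hle (≤-reflexive (cong (λ z → 2 + 2 * z) (sym (toℕ-uvIdx j t le))))))
    downUV : ∀ σ h h₀ H g R t (le : t ≤ fj) → Inv j σ h → h (fs j) ≡ H → Unchanged h h₀ → 1 ≤ g →
      g ≤ σ (vAt j t (s≤s le)) → R ≤ σ r → H ≤ 2 + 2 * t →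
      Leaves σ h (vAt j t (s≤s le)) (uAt j t (s≤s le)) g →
      Cont h₀ H (uAt j t (s≤s le)) g R → Strat σ h
    downUV σ h h₀ H g R t le inv hH un g1 ga Rr Hle leaving k =
      walk σ h h₀ H (uv j (uvIdx j t le)) false _ _ g R refl refl (λ ()) (inj₁ refl) (λ ())
        inv hH un g1 ga Rr ke leaving k
      where
      ke : contam h (uv j (uvIdx j t le)) ≡ false
      ke = above⇒clear h (uv j (uvIdx j t le)) (≤-trans (≤-reflexive hH) (≤-trans Hle (≤-reflexive (cong (λ z → 2 + 2 * z) (sym (toℕ-uvIdx j t le))))))
    upVU : ∀ σ h h₀ H g R t (lt : t < fj) → Inv j σ h → h (fs j) ≡ H → Unchanged h h₀ → 1 ≤ g →
      g ≤ σ (vAt j t (below-top lt)) → R ≤ σ r → H ≤ 3 + 2 * t →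
      Leaves σ h (vAt j t (below-top lt)) (uAt j (suc t) (s≤s lt)) g →
      Cont h₀ H (uAt j (suc t) (s≤s lt)) g R → Strat σ h
    upVU σ h h₀ H g R t lt inv hH un g1 ga Rr Hle leaving k =
      walk σ h h₀ H (vu j (vuIdx j t lt)) true _ _ g R (vu-lower j t lt) refl (λ ()) (inj₁ refl) (λ ())
        inv hH un g1 ga Rr ke leaving k
      where
      ke : contam h (vu j (vuIdx j t lt)) ≡ false
      ke = above⇒clear h (vu j (vuIdx j t lt)) (≤-trans (≤-reflexive hH) (≤-trans Hle (≤-reflexive (cong (λ z → 3 + 2 * z) (sym (toℕ-vuIdx j t lt))))))
    downVU : ∀ σ h h₀ H g R t (lt : t < fj) → Inv j σ h → h (fs j) ≡ H → Unchanged h h₀ → 1 ≤ g →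
      g ≤ σ (uAt j (suc t) (s≤s lt)) → R ≤ σ r → H ≤ 3 + 2 * t →
      Leaves σ h (uAt j (suc t) (s≤s lt)) (vAt j t (below-top lt)) g →
      Cont h₀ H (vAt j t (below-top lt)) g R → Strat σ h
    downVU σ h h₀ H g R t lt inv hH un g1 ga Rr Hle leaving k =
      walk σ h h₀ H (vu j (vuIdx j t lt)) false _ _ g R refl (vu-lower j t lt) (λ ()) (inj₁ refl) (λ ())
        inv hH un g1 ga Rr ke leaving k
      where
      ke : contam h (vu j (vuIdx j t lt)) ≡ false
      ke = above⇒clear h (vu j (vuIdx j t lt)) (≤-trans (≤-reflexive hH) (≤-trans Hle (≤-reflexive (cong (λ z → 3 + 2 * z) (sym (toℕ-vuIdx j t lt))))))

    upYV : ∀ σ h h₀ A R → Inv j σ h → h (fs j) ≡ 0 → Unchanged h h₀ → 1 ≤ A → A ≤ σ yj → R ≤ σ r →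
      Cont h₀ 0 v0 A R → Strat σ h
    upYV σ h h₀ A R inv hH un A1 ga Rr k =
      walk σ h h₀ 0 (vy j) false yj v0 A R refl refl (λ ()) (inj₁ refl) (λ ()) inv hH un A1 ga Rr
        (above⇒clear h (vy j) (subst (_≤ 1) (sym hH) z≤n)) (λ fr _ → ⊥-elim (front-cleared hH fr)) k

    -- the team clears the next path edge downwards; the arrival vertex
    -- becomes the frontier and needs its weight
    clearDownVU : ∀ σ h h₀ g R t (lt : t < fj) → Inv j σ h → h (fs j) ≡ 4 + 2 * t → Unchanged h h₀ → 1 ≤ g →
      g ≤ σ (uAt j (suc t) (s≤s lt)) → R ≤ σ r → p j t ≤ g →
      Cont h₀ (3 + 2 * t) (vAt j t (below-top lt)) g R → Strat σ h
    clearDownVU σ h h₀ g R t lt inv hH un g1 gU Rr wt k =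
      clear σ h h₀ e false (uAt j (suc t) (s≤s lt)) (vAt j t (below-top lt)) g R refl refl (vu-lower j t lt) (λ ()) (inj₁ refl) (λ ())
        inv hb un g1 gU Rr rk newFront (cont-at rk2 k)
      where
      e : E
      e = vu j (vuIdx j t lt)
      rk2 : rank e ≡ 3 + 2 * t
      rk2 = cong (λ z → 3 + 2 * z) (toℕ-vuIdx j t lt)
      hb : h (fs j) ≡ suc (rank e)
      hb = trans hH (cong suc (sym rk2))
      rk : rank e ≤ 3 + 2 * fj
      rk = ≤-trans (≤-reflexive rk2) (+-monoʳ-≤ 3 (double-mono (<⇒≤ lt)))
      newFront : ∀ {x} → Front (fs j) (rank e) x → wv x ≤ slide σ (uAt j (suc t) (s≤s lt)) (vAt j t (below-top lt)) g x
      newFront fr = arrival-guards σ _ _ g (λ ()) (subst (_≤ g) (sym (weight-v j t (below-top lt))) wt) (front-v lt rk2 fr)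
    clearDownUV : ∀ σ h h₀ g R t (t1 : 1 ≤ t) (lt : t < fj) → Inv j σ h → h (fs j) ≡ 3 + 2 * t → Unchanged h h₀ → 1 ≤ g →
      g ≤ σ (vAt j t (below-top lt)) → R ≤ σ r → 2 * L ∸ t ≤ g →
      Cont h₀ (2 + 2 * t) (uAt j t (below-top lt)) g R → Strat σ h
    clearDownUV σ h h₀ g R t t1 lt inv hH un g1 gV Rr wt k =
      clear σ h h₀ e false (vAt j t (below-top lt)) (uAt j t (below-top lt)) g R refl refl refl (λ ()) (inj₁ refl) (λ ())
        inv hb un g1 gV Rr rk newFront (cont-at rk2 k)
      where
      e : E
      e = uv j (uvIdx j t (<⇒≤ lt))
      rk2 : rank e ≡ 2 + 2 * t
      rk2 = cong (λ z → 2 + 2 * z) (toℕ-uvIdx j t (<⇒≤ lt))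
      hb : h (fs j) ≡ suc (rank e)
      hb = trans hH (cong suc (sym rk2))
      rk : rank e ≤ 3 + 2 * fj
      rk = ≤-trans (≤-reflexive rk2) (≤-trans (+-monoʳ-≤ 2 (double-mono (<⇒≤ lt))) (n≤1+n _))
      newFront : ∀ {x} → Front (fs j) (rank e) x → wv x ≤ slide σ (vAt j t (below-top lt)) (uAt j t (below-top lt)) g x
      newFront fr = arrival-guards σ _ _ g (λ ()) (subst (_≤ g) (sym (weight-u j t (below-top lt))) wt) (front-u t1 (<⇒≤ lt) rk2 fr)

    clearUV0 : ∀ σ h h₀ g R → fj ≡ 0 → Inv j σ h → h (fs j) ≡ 3 → Unchanged h h₀ → 1 ≤ g →
      g ≤ σ u0 → R ≤ σ r → p j 0 ≤ g → Cont h₀ 2 v0 g R → Strat σ h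
    clearUV0 σ h h₀ g R f0 inv hH un g1 gU Rr wt k =
      clear σ h h₀ (uv j (uvIdx j 0 z≤n)) true u0 v0 g R refl refl refl (λ ()) (inj₁ refl) (λ ())
        inv hH un g1 gU Rr (≤-trans (n≤1+n 2) (m≤m+n 3 _)) newFront k
      where
      newFront : ∀ {x} → Front (fs j) 2 x → wv x ≤ slide σ u0 v0 g x
      newFront fr = arrival-guards σ _ _ g (λ ()) wt (front-v0 refl fr)

    -- the team clears v^0 y; y needs its weight 3L
    clearVY : ∀ σ h h₀ g R → Inv j σ h → h (fs j) ≡ 2 → Unchanged h h₀ → 1 ≤ g →
      g ≤ σ v0 → R ≤ σ r → 3 * L ≤ g → Cont h₀ 1 yj g R → Strat σ h
    clearVY σ h h₀ g R inv hH un g1 gV Rr wt k =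
      clear σ h h₀ (vy j) true v0 yj g R refl refl refl (λ ()) (inj₁ refl) (λ ())
        inv hH un g1 gV Rr (s≤s z≤n) newFront k
      where
      newFront : ∀ {x} → Front (fs j) 1 x → wv x ≤ slide σ v0 yj g x
      newFront fr = arrival-guards σ _ _ g (λ ()) wt (front-y refl fr)

    -- Sweep: one searcher slides from X along the top contaminated edge e
    -- to Y and back; the team of g on X keeps X guarded meanwhile.
    sweep : ∀ σ h h₀ g R e dir X Y H' →
      branch e ≡ fs j → proj₁ (oriented G dir e) ≡ X → proj₂ (oriented G dir e) ≡ Y → X ≢ Y →
      branchOf X ≡ fs j → branchOf Y ≡ fs j → X ≢ r → Y ≢ r →
      Inv j σ h → h (fs j) ≡ suc H' → rank e ≡ H' → H' ≤ 3 + 2 * fj → Unchanged h h₀ →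
      1 ≤ g → g ≤ σ X → R ≤ σ r →
      (∀ {x} → Front (fs j) H' x → x ≡ X × wv X ≤ g ∸ 1) →
      Cont h₀ H' X g R → Strat σ h
    sweep σ h h₀ g R e dir X Y H' eb eX eY X≢Y bX bY Xr Yr inv hH rk rk≤ un g1 gX Rr front k =
      clearStep j σ h e dir 1 X Y eb eX eY ≤-refl (≤-trans g1 gX) X≢Y (inj₁ bX) hb inv ri1 newFront λ inv1 →
      walkStep j σ1 h1 e (not dir) 1 Y X (trans (reverse-from dir e) eY) (trans (reverse-to dir e) eX) ≤-refl
        (slide-delivers σ X Y 1 X≢Y) (λ e → X≢Y (sym e)) (inj₁ bY) ke inv1 ri2 leaving λ inv2 →
      k _ h1 inv2 (trans (setH-same h (fs j) (rank e)) rk) (unchanged-setH h h₀ _ un) gX2 Rr2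
      where
      σ1 : V → ℕ
      σ1 = slide σ X Y 1
      h1 : Heights
      h1 = setH h (fs j) (rank e)
      hb : h (fs j) ≡ suc (rank e)
      hb = trans hH (cong suc (sym rk))
      ri1 : RootInv σ1 h1
      ri1 = rootInv-setH σ1 h j (rank e) (subst (_≤ 3 + 2 * fj) (sym rk) rk≤)
              (rootInv-slide σ h X Y 1 Xr (rootInv inv))
      ri2 : RootInv (slide σ1 Y X 1) h1
      ri2 = rootInv-slide σ1 h1 Y X 1 Yr ri1
      σ1X : σ1 X ≡ σ X ∸ 1
      σ1X = slide-from σ X Y 1
      -- the new frontier, if any, is X, still guarded by g − 1 searchers
      newFront : ∀ {x} → Front (fs j) (rank e) x → wv x ≤ σ1 x
      newFront fr with front (subst (λ t → Front (fs j) t _) rk fr)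
      ... | refl , wX = ≤-trans wX (≤-trans (∸-monoˡ-≤ 1 gX) (≤-reflexive (sym σ1X)))
      ke : contam h1 e ≡ false
      ke = lower-clears h e (fs j) eb
      leaving : Leaves σ1 h1 Y X 1
      leaving fr refl = ⊥-elim (X≢Y (sym (proj₁ (front (subst (λ t → Front (fs j) t _)
                                              (trans (setH-same h (fs j) (rank e)) rk) fr)))))
      gX2 : g ≤ slide σ1 Y X 1 X
      gX2 = subst (g ≤_) (sym (trans (slide-to σ1 Y X 1 (λ e → X≢Y (sym e)))
                                     (trans (cong (_+ 1) σ1X) (m∸n+n≡m (≤-trans g1 gX))))) gX
      Rr2 : R ≤ slide σ1 Y X 1 r
      Rr2 = ≤-trans Rr (≤-trans (slide-keeps σ X Y 1 r (λ e → Xr (sym e)))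
                                (slide-keeps σ1 Y X 1 r (λ e → Yr (sym e))))

    sweepTop : ∀ σ h h₀ g R → Inv j σ h → h (fs j) ≡ 3 + 2 * fj → Unchanged h h₀ → 1 ≤ fj → 1 ≤ g →
      g ≤ σ top → R ≤ σ r → 2 * L ∸ fj ≤ g ∸ 1 → Cont h₀ (2 + 2 * fj) top g R → Strat σ h
    sweepTop σ h h₀ g R inv hH un f1 g1 gU Rr wt =
      sweep σ h h₀ g R (uv j (uvIdx j fj ≤-refl)) true top (vAt j fj ≤-refl) (2 + 2 * fj)
        refl refl refl (λ ()) refl refl (λ ()) (λ ()) inv hH
        (cong (λ t → 2 + 2 * t) (toℕ-uvIdx j fj ≤-refl)) (n≤1+n _) un g1 gU Rr
        (λ fr → front-u f1 ≤-refl refl fr , subst (_≤ g ∸ 1) (sym (weight-u j fj ≤-refl)) wt)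

    sweepBottom : ∀ σ h h₀ g R → 1 ≤ fj → Inv j σ h → h (fs j) ≡ 3 → Unchanged h h₀ → 1 ≤ g →
      g ≤ σ v0 → R ≤ σ r → p j 0 ≤ g ∸ 1 → Cont h₀ 2 v0 g R → Strat σ h
    sweepBottom σ h h₀ g R f1 inv hH un g1 gV Rr wt =
      sweep σ h h₀ g R (uv j (uvIdx j 0 z≤n)) false v0 u0 2 refl refl refl (λ ()) refl refl (λ ()) (λ ())
        inv hH refl (≤-trans (n≤1+n 2) (m≤m+n 3 _)) un g1 gV Rr (λ fr → front-v0 refl fr , wt)

    sweepYZ : ∀ σ h h₀ g R → Inv j σ h → h (fs j) ≡ 1 → Unchanged h h₀ → 1 ≤ g →
      g ≤ σ yj → R ≤ σ r → Cont h₀ 0 yj g R → Strat σ h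
    sweepYZ σ h h₀ g R inv hH un g1 gY Rr =
      sweep σ h h₀ g R (yz (fs j)) true yj zj 0 refl refl refl (λ ()) refl refl (λ ()) (λ ())
        inv hH refl z≤n un g1 gY Rr (λ fr → ⊥-elim (front-cleared refl fr))

    module Walks (m : ℕ) (ml : m < fj) (H : ℕ) (Hle : H ≤ 3 + 2 * m)
                 (frontIsVm : ∀ {x} → Front (fs j) H x → x ≡ vAt j m (below-top ml)) where

      notFront-u : ∀ h t .(l : t < suc fj) → h (fs j) ≡ H → NotFront h (uAt j t l)
      notFront-u h t l hH fr e with trans (sym e) (frontIsVm (subst (λ z → Front (fs j) z _) hH fr))
      ... | ()

      notFront-v : ∀ h t .(l : t < suc fj) → t ≢ m → h (fs j) ≡ H → NotFront h (vAt j t l)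
      notFront-v h t l tm hH fr e = tm (vAt-injective (trans (sym e) (frontIsVm (subst (λ z → Front (fs j) z _) hH fr))))

      walkUp : ∀ σ h h₀ g R t (le : suc t ≤ fj) s → suc t + s ≡ fj → m ≤ t →
        Inv j σ h → h (fs j) ≡ H → Unchanged h h₀ → 1 ≤ g → g ≤ σ (uAt j (suc t) (s≤s le)) → R ≤ σ r →
        ContHome h₀ H (R + g) → Strat σ h
      walkUp σ h h₀ g R t le zero eq mt inv hH un g1 ga Rr k =
        exitToRoot σ h h₀ H g R inv hH un g1 (subst (λ z → g ≤ σ z) (uAt-cong {suc t} {fj} {s≤s le} {≤-refl} (trans (sym (+-identityʳ _)) eq)) ga) Rr
          (≤-trans Hle (+-monoʳ-≤ 3 (double-mono (<⇒≤ ml)))) (notFront-u h fj ≤-refl hH) k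
      walkUp σ h h₀ g R t le (suc s) eq mt inv hH un g1 ga Rr k =
        upUV σ h h₀ H g R (suc t) le inv hH un g1 ga Rr
          (≤-trans Hle (≤-trans (+-monoʳ-≤ 3 (double-mono mt)) (≤-trans (n≤1+n _) (≤-reflexive (cong (2 +_) (sym (double-suc t)))))))
          (notFront⇒leaves σ h _ _ g (notFront-u h (suc t) (s≤s le) hH))
          λ σ1 h1 inv1 hH1 un1 g1' R1 →
        upVU σ1 h1 h₀ H g R (suc t) lt' inv1 hH1 un1 g1 g1' R1
          (≤-trans Hle (+-monoʳ-≤ 3 (double-mono (≤-trans mt (n≤1+n t)))))
          (notFront⇒leaves σ1 h1 _ _ g (notFront-v h1 (suc t) (below-top lt') (λ q → 1+n≰n (subst (_≤ t) (sym q) mt)) hH1))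
          λ σ2 h2 inv2 hH2 un2 g2 R2 →
        walkUp σ2 h2 h₀ g R (suc t) lt' s (trans (sym (+-suc (suc t) s)) eq) (≤-trans mt (n≤1+n t)) inv2 hH2 un2 g1 g2 R2 k
        where
        lt' : suc t < fj
        lt' = subst (suc (suc t) ≤_) eq (≤-trans (m≤m+n (suc (suc t)) s) (≤-reflexive (sym (+-suc (suc t) s))))

      walkDown : ∀ σ h h₀ g R t (lt : t < fj) s → t ≡ m + s →
        Inv j σ h → h (fs j) ≡ H → Unchanged h h₀ → 1 ≤ g → g ≤ σ (uAt j (suc t) (s≤s lt)) → R ≤ σ r →
        Cont h₀ H (vAt j m (below-top ml)) g R → Strat σ h
      walkDown σ h h₀ g R t lt s eq inv hH un g1 ga Rr k =
        downVU σ h h₀ H g R t lt inv hH un g1 ga Rr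
          (≤-trans Hle (+-monoʳ-≤ 3 (double-mono (subst (m ≤_) (sym eq) (m≤m+n m s)))))
          (notFront⇒leaves σ h _ _ g (notFront-u h (suc t) (s≤s lt) hH))
          (cont t lt s eq)
        where
        cont : ∀ t (lt : t < fj) s → t ≡ m + s → Cont h₀ H (vAt j t (below-top lt)) g R
        cont t lt zero eq = cont-v (trans eq (+-identityʳ m)) k
        cont zero lt (suc s) eq with trans eq (+-suc m s)
        ... | ()
        cont (suc t') lt (suc s) eq σ1 h1 inv1 hH1 un1 g1' R1 =
          downUV σ1 h1 h₀ H g R (suc t') (<⇒≤ lt) inv1 hH1 un1 g1 g1' R1
            (≤-trans Hle (≤-trans (+-monoʳ-≤ 3 (double-mono mt')) (≤-trans (n≤1+n _) (≤-reflexive (cong (2 +_) (sym (double-suc t')))))))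
            (notFront⇒leaves σ1 h1 _ _ g (notFront-v h1 (suc t') (below-top lt) (λ q → 1+n≰n (subst (_≤ t') (sym q) mt')) hH1))
            λ σ2 h2 inv2 hH2 un2 g2 R2 →
          walkDown σ2 h2 h₀ g R t' (≤-trans (n≤1+n _) lt) s eq' inv2 hH2 un2 g1 g2 R2 k
          where
          eq' : t' ≡ m + s
          eq' = suc-injective (trans eq (+-suc m s))
          mt' : m ≤ t'
          mt' = subst (m ≤_) (sym eq') (m≤m+n m s)

    clearDown : ∀ σ h h₀ g R m' (ml' : m' < fj) t (lt : t < fj) s → t ≡ m' + s →
      Inv j σ h → h (fs j) ≡ 3 + 2 * t → Unchanged h h₀ → 1 ≤ g → g ≤ σ (vAt j t (below-top lt)) → R ≤ σ r →
      (∀ t' → m' < t' → t' < fj → 2 * L ∸ t' ≤ g) → (∀ t' → t' < fj → p j t' ≤ g) →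
      Cont h₀ (3 + 2 * m') (vAt j m' (below-top ml')) g R → Strat σ h
    clearDown σ h h₀ g R m' ml' t lt zero eq inv hH un g1 gV Rr w1 w2 k =
      k σ h inv (trans hH (cong (λ z → 3 + 2 * z) e)) un (subst (λ z → g ≤ σ z) (vAt-cong {t} {m'} {below-top lt} {below-top ml'} e) gV) Rr
      where
      e : t ≡ m'
      e = trans eq (+-identityʳ m')
    clearDown σ h h₀ g R m' ml' zero lt (suc s) eq inv hH un g1 gV Rr w1 w2 k with trans eq (+-suc m' s)
    ... | ()
    clearDown σ h h₀ g R m' ml' (suc t') lt (suc s) eq inv hH un g1 gV Rr w1 w2 k =
      clearDownUV σ h h₀ g R (suc t') (s≤s z≤n) lt inv hH un g1 gV Rr
        (w1 (suc t') (s≤s (subst (m' ≤_) (sym eq') (m≤m+n m' s))) lt)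
        λ σ1 h1 inv1 hH1 un1 g1' R1 →
      clearDownVU σ1 h1 h₀ g R t' lt' inv1 (trans hH1 (cong (2 +_) (double-suc t'))) un1 g1 g1' R1 (w2 t' lt')
        λ σ2 h2 inv2 hH2 un2 g2 R2 →
      clearDown σ2 h2 h₀ g R m' ml' t' lt' s eq' inv2 hH2 un2 g1 g2 R2 w1 w2 k
      where
      eq' : t' ≡ m' + s
      eq' = suc-injective (trans eq (+-suc m' s))
      lt' : t' < fj
      lt' = ≤-trans (n≤1+n _) lt

    -- Phases (1)/(2) on branch fs j (f_j ≥ 1): the team of g clears the
    -- branch from the top down to v^m, leaves p_j(m) searchers there as a
    -- guard and returns to r.
    guardBranch : ∀ σ h h₀ g R m (ml : m < fj) → 1 ≤ fj →
      Inv j σ h → h (fs j) ≡ 4 + 2 * fj → Unchanged h h₀ → R + g ≤ σ r →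
      ((2 * L ≤ R) ⊎ (∀ k → k ≢ j → h (fs k) ≤ 3 + 2 * f k)) →
      2 * L ∸ fj ≤ g ∸ 1 → (∀ t' → m < t' → t' < fj → 2 * L ∸ t' ≤ g) → (∀ t' → t' < fj → p j t' ≤ g) →
      p j m < g →
      ContHome h₀ (3 + 2 * m) (R + (g ∸ p j m)) → Strat σ h
    guardBranch σ h h₀ g R m ml f1 inv hH un Rg RA wtop wu wp pg k =
      enter σ h h₀ g R inv hH un g1 Rg (≤-trans wtop (m∸n≤m g 1)) RA λ σ1 h1 inv1 hH1 un1 gU1 R1 →
      sweepTop σ1 h1 h₀ g R inv1 hH1 un1 f1 g1 gU1 R1 wtop λ σ2 h2 inv2 hH2 un2 gU2 R2 →
      clearDownVU σ2 h2 h₀ g R F' ltF' inv2 (trans hH2 H2eq) un2 g1 (subst (λ z → g ≤ σ2 z) (uAt-cong {fj} {suc F'} {≤-refl} {s≤s ltF'} eF) gU2) R2 (wp F' ltF')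
        λ σ3 h3 inv3 hH3 un3 gV3 R3 →
      clearDown σ3 h3 h₀ g R m ml F' ltF' (F' ∸ m) (sym (m+[n∸m]≡n (≤-pred (subst (m <_) eF ml))))
        inv3 hH3 un3 g1 gV3 R3 wu wp λ σ4 h4 inv4 hH4 un4 gV4 R4 →
      upVU σ4 h4 h₀ (3 + 2 * m) g' R m ml inv4 hH4 un4 g'1 (≤-trans (m∸n≤m g (p j m)) gV4) R4 ≤-refl
        (guardStays σ4 h4 gV4)
        λ σ5 h5 inv5 hH5 un5 g5 R5 →
      W.walkUp σ5 h5 h₀ g' R m ml (fj ∸ suc m) (m+[n∸m]≡n ml) ≤-refl inv5 hH5 un5 g'1 g5 R5 k
      where
      g1 : 1 ≤ g
      g1 = ≤-trans (s≤s z≤n) pg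
      F' : ℕ
      F' = fj ∸ 1
      eF : fj ≡ suc F'
      eF = fj≡1+ f1
      ltF' : F' < fj
      ltF' = subst (F' <_) (sym eF) ≤-refl
      H2eq : 2 + 2 * fj ≡ 4 + 2 * F'
      H2eq = trans (cong (λ z → 2 + 2 * z) eF) (cong (2 +_) (double-suc F'))
      g' : ℕ
      g' = g ∸ p j m
      g'1 : 1 ≤ g'
      g'1 = m+n≤o⇒m≤o∸n 1 pg
      module W = Walks m ml (3 + 2 * m) ≤-refl (λ fr → front-v ml refl fr)
      guardStays : ∀ σ4 h4 → g ≤ σ4 (vAt j m (below-top ml)) →
                   Leaves σ4 h4 (vAt j m (below-top ml)) (uAt j (suc m) (s≤s ml)) g'
      guardStays σ4 h4 gV fr refl =
        subst (_≤ slide σ4 vm (uAt j (suc m) (s≤s ml)) g' vm) (sym (weight-v j m (below-top ml)))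
          (slide-leaves σ4 vm (uAt j (suc m) (s≤s ml)) (<⇒≤ pg) gV)
        where
        vm : V
        vm = vAt j m (below-top ml)

    guardBranch₀ : ∀ σ h h₀ g R → fj ≡ 0 →
      Inv j σ h → h (fs j) ≡ 4 + 2 * fj → Unchanged h h₀ → R + g ≤ σ r →
      ((2 * L ≤ R) ⊎ (∀ k → k ≢ j → h (fs k) ≤ 3 + 2 * f k)) →
      2 * L ∸ fj ≤ g → p j 0 < g →
      ContHome h₀ 2 (R + (g ∸ p j 0)) → Strat σ h
    guardBranch₀ σ h h₀ g R f0 inv hH un Rg RA wtop pg k =
      enter σ h h₀ g R inv hH un g1 Rg wtop RA λ σ1 h1 inv1 hH1 un1 gU1 R1 →
      clearUV0 σ1 h1 h₀ g R f0 inv1 (trans hH1 (cong (λ z → 3 + 2 * z) f0)) un1 g1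
        (subst (λ z → g ≤ σ1 z) (uAt-cong {fj} {0} {≤-refl} {s≤s z≤n} f0) gU1) R1 (<⇒≤ pg)
        λ σ2 h2 inv2 hH2 un2 gV2 R2 →
      downUV σ2 h2 h₀ 2 g' R 0 z≤n inv2 hH2 un2 g'1 (≤-trans (m∸n≤m g (p j 0)) gV2) R2 ≤-refl
        (guardStays σ2 h2 gV2)
        λ σ3 h3 inv3 hH3 un3 gU3 R3 →
      exitToRoot σ3 h3 h₀ 2 g' R inv3 hH3 un3 g'1 (subst (λ z → g' ≤ σ3 z) (uAt-cong {0} {fj} {s≤s z≤n} {≤-refl} (sym f0)) gU3) R3
        (≤-trans (n≤1+n 2) (m≤m+n 3 _)) (top-not-front h3 hH3) k
      where
      g1 : 1 ≤ g
      g1 = ≤-trans (s≤s z≤n) pg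
      g' : ℕ
      g' = g ∸ p j 0
      g'1 : 1 ≤ g'
      g'1 = m+n≤o⇒m≤o∸n 1 pg
      guardStays : ∀ σ2 h2 → g ≤ σ2 v0 → Leaves σ2 h2 v0 u0 g'
      guardStays σ2 h2 gV fr refl = slide-leaves σ2 v0 u0 (<⇒≤ pg) gV
      top-not-front : ∀ h3 → h3 (fs j) ≡ 2 → NotFront h3 top
      top-not-front h3 hH3 fr e with trans (sym e) (front-v0 hH3 fr)
      ... | ()

    -- Phase (3) on a branch guarded at v^m (f_j ≥ 1): a team of A ≥ 3L
    -- walks down to the guard, absorbs it, clears the rest of the branch
    -- and returns to r.
    finishBranch : ∀ σ h h₀ A R m (ml : m < fj) → 1 ≤ fj →
      Inv j σ h → h (fs j) ≡ 3 + 2 * m → Unchanged h h₀ → R + A ≤ σ r → (∀ k → h (fs k) ≤ 3 + 2 * f k) →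
      1 ≤ A → 3 * L ≤ A → 2 * L ≤ A → (∀ t' → t' < fj → p j t' ≤ A) → p j 0 ≤ A ∸ 1 →
      ContHome h₀ 0 (R + A) → Strat σ h
    finishBranch σ h h₀ A R m ml f1 inv hH un RA allc A1 w3 w2L wp wp0 k =
      entryFromRoot σ h h₀ (3 + 2 * m) A R inv hH un A1 RA (+-monoʳ-≤ 3 (double-mono (<⇒≤ ml))) allc
        λ σ1 h1 inv1 hH1 un1 gU1 R1 →
      W.walkDown σ1 h1 h₀ A R F' ltF' (F' ∸ m) (sym (m+[n∸m]≡n (≤-pred (subst (m <_) eF ml))))
        inv1 hH1 un1 A1 (subst (λ z → A ≤ σ1 z) (uAt-cong {fj} {suc F'} {≤-refl} {s≤s ltF'} eF) gU1) R1
        λ σ2 h2 inv2 hH2 un2 gV2 R2 →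
      clearDown σ2 h2 h₀ A R 0 f1 m ml m refl inv2 hH2 un2 A1 gV2 R2
        (λ t' _ _ → ≤-trans (m∸n≤m (2 * L) t') w2L) wp
        λ σ3 h3 inv3 hH3 un3 gV3 R3 →
      sweepBottom σ3 h3 h₀ A R f1 inv3 hH3 un3 A1 gV3 R3 wp0 λ σ4 h4 inv4 hH4 un4 gV4 R4 →
      clearVY σ4 h4 h₀ A R inv4 hH4 un4 A1 gV4 R4 w3 λ σ5 h5 inv5 hH5 un5 gY5 R5 →
      sweepYZ σ5 h5 h₀ A R inv5 hH5 un5 A1 gY5 R5 λ σ6 h6 inv6 hH6 un6 gY6 R6 →
      upYV σ6 h6 h₀ A R inv6 hH6 un6 A1 gY6 R6 λ σ7 h7 inv7 hH7 un7 gV7 R7 →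
      upVU σ7 h7 h₀ 0 A R 0 f1 inv7 hH7 un7 A1 gV7 R7 z≤n (λ fr _ → ⊥-elim (front-cleared hH7 fr))
        λ σ8 h8 inv8 hH8 un8 gU8 R8 →
      W0.walkUp σ8 h8 h₀ A R 0 f1 F' (sym eF) z≤n inv8 hH8 un8 A1 gU8 R8 k
      where
      F' : ℕ
      F' = fj ∸ 1
      eF : fj ≡ suc F'
      eF = fj≡1+ f1
      ltF' : F' < fj
      ltF' = subst (F' <_) (sym eF) ≤-refl
      module W = Walks m ml (3 + 2 * m) ≤-refl (λ fr → front-v ml refl fr)
      module W0 = Walks 0 f1 0 z≤n (λ fr → ⊥-elim (front-cleared refl fr))

    finishBranch₀ : ∀ σ h h₀ A R → fj ≡ 0 →
      Inv j σ h → h (fs j) ≡ 2 → Unchanged h h₀ → R + A ≤ σ r → (∀ k → h (fs k) ≤ 3 + 2 * f k) →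
      1 ≤ A → 3 * L ≤ A →
      ContHome h₀ 0 (R + A) → Strat σ h
    finishBranch₀ σ h h₀ A R f0 inv hH un RA allc A1 w3 k =
      entryFromRoot σ h h₀ 2 A R inv hH un A1 RA (≤-trans (n≤1+n 2) (m≤m+n 3 _)) allc
        λ σ1 h1 inv1 hH1 un1 gU1 R1 →
      upUV σ1 h1 h₀ 2 A R 0 z≤n inv1 hH1 un1 A1 (subst (λ z → A ≤ σ1 z) (uAt-cong {fj} {0} {≤-refl} {s≤s z≤n} f0) gU1) R1 ≤-refl
        (λ fr e → ⊥-elim (u≢v (trans (sym e) (front-v0 hH1 fr))))
        λ σ2 h2 inv2 hH2 un2 gV2 R2 →
      clearVY σ2 h2 h₀ A R inv2 hH2 un2 A1 gV2 R2 w3 λ σ5 h5 inv5 hH5 un5 gY5 R5 →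
      sweepYZ σ5 h5 h₀ A R inv5 hH5 un5 A1 gY5 R5 λ σ6 h6 inv6 hH6 un6 gY6 R6 →
      upYV σ6 h6 h₀ A R inv6 hH6 un6 A1 gY6 R6 λ σ7 h7 inv7 hH7 un7 gV7 R7 →
      downUV σ7 h7 h₀ 0 A R 0 z≤n inv7 hH7 un7 A1 gV7 R7 z≤n (λ fr _ → ⊥-elim (front-cleared hH7 fr))
        λ σ8 h8 inv8 hH8 un8 gU8 R8 →
      exitToRoot σ8 h8 h₀ 0 A R inv8 hH8 un8 A1 (subst (λ z → A ≤ σ8 z) (uAt-cong {0} {fj} {s≤s z≤n} {≤-refl} (sym f0)) gU8) R8
        z≤n (λ fr _ → front-cleared hH8 fr) k
      where
      u≢v : ∀ {a b : Fin (suc fj)} → u j a ≡ v j b → ⊥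
      u≢v ()

  -- Phase (0).  hFresh: everything contaminated; hStart: branch fz clear,
  -- every other branch completely contaminated.
  hFresh : Heights
  hFresh fz = 2
  hFresh (fs k) = 4 + 2 * f k

  hStart : Heights
  hStart fz = 0
  hStart (fs k) = 4 + 2 * f k

  κ-y₀z₀ : E → Bool
  κ-y₀z₀ (yz fz) = false
  κ-y₀z₀ _ = true

  fresh-rank : ∀ e {j} → branch e ≡ fs j → rank e < 4 + 2 * f j
  fresh-rank (uv j i) refl = s≤s (≤-trans (+-monoʳ-≤ 2 (double-mono (FP.toℕ≤pred[n] i))) (n≤1+n _))
  fresh-rank (vu j i) refl = s≤s (+-monoʳ-≤ 3 (double-mono (<⇒≤ (FP.toℕ<n i))))
  fresh-rank (ru j) refl = ≤-refl
  fresh-rank (vy j) refl = s≤s (s≤s z≤n)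
  fresh-rank (yz (fs k)) refl = s≤s z≤n

  hFresh-contam : ∀ e → contam hFresh e ≡ true
  hFresh-contam ry₀ = refl
  hFresh-contam (yz fz) = refl
  hFresh-contam e@(uv _ _) = below⇒contam hFresh e (fresh-rank e refl)
  hFresh-contam e@(vu _ _) = below⇒contam hFresh e (fresh-rank e refl)
  hFresh-contam e@(ru _) = below⇒contam hFresh e (fresh-rank e refl)
  hFresh-contam e@(vy _) = below⇒contam hFresh e (fresh-rank e refl)
  hFresh-contam e@(yz (fs _)) = below⇒contam hFresh e (fresh-rank e refl)

  hStart-off-ry₀ : ∀ e → e ≢ ry₀ → contam hStart e ≡ κ-y₀z₀ e
  hStart-off-ry₀ ry₀ ne = ⊥-elim (ne refl)
  hStart-off-ry₀ (yz fz) _ = refl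
  hStart-off-ry₀ e@(uv _ _) _ = below⇒contam hStart e (fresh-rank e refl)
  hStart-off-ry₀ e@(vu _ _) _ = below⇒contam hStart e (fresh-rank e refl)
  hStart-off-ry₀ e@(ru _) _ = below⇒contam hStart e (fresh-rank e refl)
  hStart-off-ry₀ e@(vy _) _ = below⇒contam hStart e (fresh-rank e refl)
  hStart-off-ry₀ e@(yz (fs _)) _ = below⇒contam hStart e (fresh-rank e refl)

  guarded-hStart : ∀ σ → Guarded σ hStart
  guarded-hStart σ {fz} fr = ⊥-elim (front-cleared refl fr)
  guarded-hStart σ {fs k} fr = ⊥-elim (front-fresh refl fr)

  κ-y₀z₀-clear : ∀ e → κ-y₀z₀ e ≡ false → e ≡ yz fz
  κ-y₀z₀-clear (yz fz) _ = refl
  κ-y₀z₀-clear (uv _ _) ()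
  κ-y₀z₀-clear (vu _ _) ()
  κ-y₀z₀-clear ry₀ ()
  κ-y₀z₀-clear (ru _) ()
  κ-y₀z₀-clear (vy _) ()
  κ-y₀z₀-clear (yz (fs _)) ()

  κ-y₀z₀-contam : ∀ e → e ≢ yz fz → κ-y₀z₀ e ≡ true
  κ-y₀z₀-contam (yz fz) ne = ⊥-elim (ne refl)
  κ-y₀z₀-contam (uv _ _) _ = refl
  κ-y₀z₀-contam (vu _ _) _ = refl
  κ-y₀z₀-contam ry₀ _ = refl
  κ-y₀z₀-contam (ru _) _ = refl
  κ-y₀z₀-contam (vy _) _ = refl
  κ-y₀z₀-contam (yz (fs _)) _ = refl

  -- Phase (0): all 4L searchers go to y₀ (r y₀ is recontaminated at once),
  -- one of them clears y₀ z₀, the other 4L − 1 clear r y₀ on the way back,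
  -- and the last one follows; this reaches hStart with 4L searchers on r.
  module Phase0 (j0 : Fin n) (L1 : 1 ≤ L) (σ₀ : V → ℕ) (σ₀r : σ₀ r ≡ 4 * L)
                (k : ∀ σ → 4 * L ≤ σ r → Strat σ hStart) where
    y₀ : V
    y₀ = y fz
    z₀ : V
    z₀ = z fz
    all4L : ℕ
    all4L = 4 * L
    all4L≥1 : 1 ≤ all4L
    all4L≥1 = ≤-trans L1 (m≤m+n L _)

    σ1 : V → ℕ
    σ1 = slide σ₀ r y₀ all4L
    σ1r : σ1 r ≡ 0
    σ1r = trans (slide-from σ₀ r y₀ all4L) (trans (cong (_∸ all4L) σ₀r) (n∸n≡0 all4L))
    σ1y : all4L ≤ σ1 y₀
    σ1y = slide-delivers σ₀ r y₀ all4L (λ ())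

    -- r is left empty, so r y₀ is recontaminated through r u_{j0}
    toY₀ : Step G ⟨ σ₀ , (λ _ → true) ⟩ ⟨ σ1 , contam hFresh ⟩
    toY₀ = record
      { e = ry₀ ; dir = true ; j = all4L ; j≥1 = all4L≥1 ; enough = ≤-reflexive (sym σ₀r)
      ; weight = λ _ → all4L≥1
      ; leave = trans (cong (_+ all4L) (slide-from σ₀ r y₀ all4L)) (m∸n+n≡m (≤-reflexive (sym σ₀r)))
      ; arrive = slide-to σ₀ r y₀ all4L (λ ())
      ; others = λ c n1 n2 → slide-elsewhere σ₀ r y₀ all4L c n1 n2
      ; contam = λ e' _ → recontaminated e'
      ; contam⁻¹ = λ e' _ → hFresh-contam e' }
      where
      recontaminated : ∀ e' → Recont G σ1 (λ e'' → (true ≡ true) × (e'' ≢ ry₀)) e'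
      recontaminated ry₀ = spread {e = ru j0} {x = r} (base (refl , λ ())) (inj₁ refl) (inj₁ refl)
                 (subst (_< 2 * L) (sym σ1r) (≤-trans (s≤s z≤n) (≤-trans L1 (m≤m+n L _))))
      recontaminated (uv a b) = base (refl , λ ())
      recontaminated (vu a b) = base (refl , λ ())
      recontaminated (ru a) = base (refl , λ ())
      recontaminated (vy a) = base (refl , λ ())
      recontaminated (yz a) = base (refl , λ ())

    nothing-clear : ClearConnected G (contam hFresh)
    nothing-clear e₁ _ k₁ _ with trans (sym (hFresh-contam e₁)) k₁
    ... | ()

    σ2 : V → ℕ
    σ2 = slide σ1 y₀ z₀ 1
    σ2y : σ2 y₀ ≡ σ1 y₀ ∸ 1
    σ2y = slide-from σ1 y₀ z₀ 1

    3L≤ : 3 * L ≤ all4L ∸ 1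
    3L≤ = m+n≤o⇒m≤o∸n (3 * L) (subst (_≤ all4L) (+-comm 1 (3 * L)) (+-monoˡ-≤ (3 * L) L1))

    σ2Y : 3 * L ≤ σ2 y₀
    σ2Y = subst (3 * L ≤_) (sym σ2y) (≤-trans 3L≤ (∸-monoˡ-≤ 1 σ1y))

    -- y₀ z₀ stays clear: y₀ keeps 3L searchers, z₀ is a leaf
    y₀z₀-safe : ∀ {x e} → κ-y₀z₀ e ≡ true → At x e → At x (yz fz) → σ2 x < wv x → ⊥
    y₀z₀-safe ke _ (yzY .fz) lt = <⇒≱ lt σ2Y
    y₀z₀-safe ke (yzZ .fz) (yzZ .fz) lt with ke
    ... | ()

    closed2 : RecontClosed σ2 κ-y₀z₀
    closed2 {e} {e'} {x} ke i1 i2 lt with κ-y₀z₀ e' in eq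
    ... | true = refl
    ... | false = ⊥-elim (y₀z₀-safe ke (atView {x} {e} i1)
                    (subst (At x) (κ-y₀z₀-clear e' eq) (atView {x} {e'} i2)) lt)

    connected2 : ClearConnected G κ-y₀z₀
    connected2 e1 e2 k1 k2 with κ-y₀z₀-clear e1 k1 | κ-y₀z₀-clear e2 k2
    ... | refl | refl = here

    toZ₀ : Step G ⟨ σ1 , contam hFresh ⟩ ⟨ σ2 , κ-y₀z₀ ⟩
    toZ₀ = slideStep σ1 (contam hFresh) κ-y₀z₀ (yz fz) true 1 y₀ z₀ refl refl ≤-refl (≤-trans all4L≥1 σ1y)
             (λ ()) ≤-refl refl (λ e' ne → trans (κ-y₀z₀-contam e' ne) (sym (hFresh-contam e'))) closed2

    σ3 : V → ℕ
    σ3 = slide σ2 y₀ r (all4L ∸ 1)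
    σ3r : all4L ∸ 1 ≤ σ3 r
    σ3r = slide-delivers σ2 y₀ r (all4L ∸ 1) (λ ())
    all4L-1≥1 : 1 ≤ all4L ∸ 1
    all4L-1≥1 = m+n≤o⇒m≤o∸n 1 (+-mono-≤ L1 (≤-trans L1 (m≤m+n L _)))

    2L≤ : 2 * L ≤ all4L ∸ 1
    2L≤ = m+n≤o⇒m≤o∸n (2 * L) (≤-trans (+-monoʳ-≤ (2 * L) (≤-trans L1 (m≤m+n L _)))
                                          (≤-reflexive (sym (*-distribʳ-+ L 2 2))))

    backToR : Step G ⟨ σ2 , κ-y₀z₀ ⟩ ⟨ σ3 , contam hStart ⟩
    backToR = slideStep σ2 κ-y₀z₀ (contam hStart) ry₀ false (all4L ∸ 1) y₀ r refl refl all4L-1≥1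
                (subst (all4L ∸ 1 ≤_) (sym σ2y) (∸-monoˡ-≤ 1 σ1y)) (λ ()) all4L-1≥1 refl hStart-off-ry₀
                (λ {e₁} {e₂} {x} → guarded⇒closed σ3 hStart (guarded-hStart σ3) (inj₁ (≤-trans 2L≤ σ3r)) {e₁} {e₂} {x})

    σ4 : V → ℕ
    σ4 = slide σ3 z₀ y₀ 1
    σ5 : V → ℕ
    σ5 = slide σ4 y₀ r 1

    z3 : 1 ≤ σ3 z₀
    z3 = ≤-trans (slide-delivers σ1 y₀ z₀ 1 (λ ())) (slide-keeps σ2 y₀ r (all4L ∸ 1) z₀ (λ ()))
    r4 : all4L ∸ 1 ≤ σ4 r
    r4 = ≤-trans σ3r (slide-keeps σ3 z₀ y₀ 1 r (λ ()))
    r5 : all4L ≤ σ5 r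
    r5 = subst (all4L ≤_) (sym (slide-to σ4 y₀ r 1 (λ ())))
           (≤-trans (≤-reflexive (sym (m∸n+n≡m all4L≥1))) (+-monoˡ-≤ 1 r4))

    run : StrategyFrom G ⟨ σ₀ , (λ _ → true) ⟩
    run = step toY₀ nothing-clear
         (step toZ₀ connected2
         (step backToR (Connectivity.connected hStart refl)
         (moveOnClear σ3 hStart (yz fz) false 1 z₀ y₀ refl refl ≤-refl z3 (λ ()) refl refl (guarded-hStart σ4)
              (inj₁ (≤-trans 2L≤ r4))
         (moveOnClear σ4 hStart ry₀ false 1 y₀ r refl refl ≤-refl (slide-delivers σ3 z₀ y₀ 1 (λ ())) (λ ()) refl refl
              (guarded-hStart σ5) (inj₁ (≤-trans (≤-trans 2L≤ (m∸n≤m all4L 1)) r5))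
         (k σ5 r5)))))

maxFin-upper : ∀ m (g : Fin m → ℕ) k → g k ≤ maxFin m g
maxFin-upper (suc m) g fz = m≤m⊔n _ _
maxFin-upper (suc m) g (fs k) = ≤-trans (maxFin-upper m (λ i → g (fs i)) k) (m≤n⊔m _ _)

argmin : ∀ {m} → 1 ≤ m → (g : Fin m → ℕ) → Σ (Fin m) λ a → ∀ b → g a ≤ g b
argmin {suc zero} _ g = fz , λ { fz → ≤-refl }
argmin {suc (suc m)} _ g with argmin (s≤s z≤n) (λ i → g (fs i))
... | (a , ha) with g fz ≤? g (fs a)
...   | yes le = fz , λ { fz → ≤-refl ; (fs b) → ≤-trans le (ha b) }
...   | no nle = fs a , λ { fz → <⇒≤ (≰⇒> nle) ; (fs b) → ha b }

-- a team of x searchers that left q of them behind and joined R others: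
-- counting the q again restores R + x
rejoined : ∀ {x q R s'} → q ≤ x → R + (x ∸ q) ≤ s' → R + x ≤ q + s'
rejoined {x} {q} {R} {s'} qx h = begin
  R + x              ≡⟨ cong (R +_) (sym (m+[n∸m]≡n qx)) ⟩
  R + (q + (x ∸ q))  ≡⟨ sym (+-assoc R q (x ∸ q)) ⟩
  R + q + (x ∸ q)    ≡⟨ cong (_+ (x ∸ q)) (+-comm R q) ⟩
  q + R + (x ∸ q)    ≡⟨ +-assoc q R (x ∸ q) ⟩
  q + (R + (x ∸ q))  ≤⟨ +-monoʳ-≤ q h ⟩
  q + s'             ∎
  where open ≤-Reasoning

zero-or-positive : ∀ m → m ≡ 0 ⊎ 1 ≤ m
zero-or-positive zero = inj₁ refl
zero-or-positive (suc m) = inj₂ (s≤s z≤n)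

module Schedule (n : ℕ) (n≥1 : 1 ≤ n) (d : Fin n → ℕ) (p : Fin n → ℕ → ℕ)
  (p≥1 : ∀ j t → t < d j → 1 ≤ p j t)
  (p-mono : ∀ j t t′ → t ≤ t′ → t′ < d j → p j t ≤ p j t′)
  (f : Fin n → ℕ) (latest : ∀ j → IsLatestStart (d j) (p j) (f j))
  (sched : FeasibleSchedule n d p) where

  open TreeM n d p f
  open FeasibleSchedule sched
  open IsLatestStart

  C : Fin n → ℕ
  C k = s k + p k (s k)

  d≤L : ∀ k → d k ≤ L
  d≤L k = maxFin-upper n d k

  p≤L : ∀ k t → t ≤ f k → p k t ≤ L
  p≤L k t le = ≤-trans (p-mono k t (f k) le (domain (latest k)))
                 (≤-trans (m≤n+m _ (f k)) (≤-trans (fits (latest k)) (d≤L k)))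

  s≤f : ∀ k → s k ≤ f k
  s≤f k = greatest (latest k) (s k) (inDomain k) (deadline k)

  C≤L : ∀ k → C k ≤ L
  C≤L k = ≤-trans (deadline k) (d≤L k)

  s<C : ∀ k → s k < C k
  s<C k = ≤-trans (≤-reflexive (+-comm 1 (s k))) (+-monoʳ-≤ (s k) (p≥1 k (s k) (inDomain k)))

  s<L : ∀ k → s k < L
  s<L k = ≤-trans (inDomain k) (d≤L k)

  ℓ : Fin n
  ℓ = proj₁ (argmin n≥1 s)
  ℓ-first : ∀ k → s ℓ ≤ s k
  ℓ-first = proj₂ (argmin n≥1 s)

  L≥1 : 1 ≤ L
  L≥1 = ≤-trans (s≤s z≤n) (s<L ℓ)

  finishes-first : ∀ k k' → k ≢ k' → s k ≤ s k' → C k ≤ s k'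
  finishes-first k k' ne le with disjoint k k' ne
  ... | inj₁ q = q
  ... | inj₂ q = ⊥-elim (<⇒≱ (<-≤-trans (s<C k') q) le)

  twoL : 2 * L ≡ L + L
  twoL = cong (L +_) (+-identityʳ L)

  fourL : 4 * L ≡ 2 * L + 2 * L
  fourL = *-distribʳ-+ L 2 2

  2L≤3L-1 : 2 * L ≤ 3 * L ∸ 1
  2L≤3L-1 = m+n≤o⇒m≤o∸n (2 * L) (≤-trans (+-monoʳ-≤ (2 * L) L≥1) (≤-reflexive (+-comm (2 * L) L)))

  -- branch fs k is cleared down to a guard on v_k^m (on v_k^0 if f k = 0)
  GuardedBranch : Heights → Fin n → Set
  GuardedBranch h k = (f k ≡ 0 × h (fs k) ≡ 2) ⊎ Σ ℕ (λ m → m < f k × h (fs k) ≡ 3 + 2 * m)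

  guarded-ru-clear : ∀ h k → GuardedBranch h k → h (fs k) ≤ 3 + 2 * f k
  guarded-ru-clear h k (inj₁ (_ , e)) = ≤-trans (≤-reflexive e) (≤-trans (n≤1+n 2) (m≤m+n 3 _))
  guarded-ru-clear h k (inj₂ (m , ml , e)) = ≤-trans (≤-reflexive e) (+-monoʳ-≤ 3 (double-mono (<⇒≤ ml)))

  guardedBranch-cong : ∀ h h' k → h' (fs k) ≡ h (fs k) → GuardedBranch h k → GuardedBranch h' k
  guardedBranch-cong h h' k e (inj₁ (a , b)) = inj₁ (a , trans e b)
  guardedBranch-cong h h' k e (inj₂ (m , ml , b)) = inj₂ (m , ml , trans e b)

  invFrom : ∀ σ h k → h fz ≡ 0 → Guarded σ h → RootInv σ h → Inv k σ h
  invFrom σ h k h0 g ri = record { clearBase = h0 ; guardOthers = λ fr _ → g fr ; guardOwn = g ; rootInv = ri }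

  guardedFrom : ∀ {j σ h} → Inv j σ h → Guarded σ h
  guardedFrom {j} {σ} {h} inv = guarded-from σ h j (guardOthers inv) (guardOwn inv)

  fs-distinct : ∀ {k k' : Fin n} → k' ≢ k → fs k' ≢ fs k
  fs-distinct ne e = ne (FP.suc-injective e)

  -- Phase (3): with 3L searchers on r and every branch guarded or
  -- cleared, the branches with index ≥ i are finished one by one.
  Settled : Heights → Set
  Settled h = ∀ k → GuardedBranch h k ⊎ h (fs k) ≡ 0

  settled-ru-clear : ∀ h → Settled h → ∀ k → h (fs k) ≤ 3 + 2 * f k
  settled-ru-clear h st k with st k
  ... | inj₁ g = guarded-ru-clear h k g
  ... | inj₂ zz = ≤-trans (≤-reflexive zz) z≤n

  finishAll : ∀ c i σ h → i + c ≡ n → h fz ≡ 0 → Guarded σ h → 3 * L ≤ σ r →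
              (∀ k → toℕ k < i → h (fs k) ≡ 0) → Settled h → Strat σ h
  finishAll zero i σ h eq h0 g r3 done< st =
    done (λ e → above⇒clear h e (subst (_≤ rank e) (sym (cleared (branch e))) z≤n))
    where
    cleared : ∀ b → h b ≡ 0
    cleared fz = h0
    cleared (fs k) = done< k (subst (toℕ k <_) (sym (trans (sym (+-identityʳ i)) eq)) (FP.toℕ<n k))
  finishAll (suc c) i σ h eq h0 g r3 done< st = byState (st k)
    where
    k : Fin n
    k = F.fromℕ< (subst (i <_) eq (m<m+n i (s≤s z≤n)))
    toℕ-k : toℕ k ≡ i
    toℕ-k = FP.toℕ-fromℕ< _
    eq' : suc i + c ≡ n
    eq' = trans (sym (+-suc i c)) eq
    below-next : ∀ k' → toℕ k' < suc i → k' ≢ k → toℕ k' < i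
    below-next k' lt ne with m≤n⇒m<n∨m≡n (≤-pred lt)
    ... | inj₁ q = q
    ... | inj₂ q = ⊥-elim (ne (FP.toℕ-injective (trans q (sym toℕ-k))))
    allClear : ∀ k → h (fs k) ≤ 3 + 2 * f k
    allClear = settled-ru-clear h st
    inv : Inv k σ h
    inv = invFrom σ h k h0 g (inj₂ allClear)
    open Branch k
    continue : ContHome h 0 (0 + 3 * L)
    continue σ' h' inv' hk un r3' = finishAll c (suc i) σ' h' eq' (clearBase inv') (guardedFrom inv') r3' done' st'
      where
      done' : ∀ k' → toℕ k' < suc i → h' (fs k') ≡ 0
      done' k' lt with k' FP.≟ k
      ... | yes refl = hk
      ... | no ne = trans (un (fs k') (fs-distinct ne)) (done< k' (below-next k' lt ne))
      st' : Settled h'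
      st' k' with k' FP.≟ k
      ... | yes refl = inj₂ hk
      ... | no ne with st k'
      ...   | inj₁ gb = inj₁ (guardedBranch-cong h h' k' (un (fs k') (fs-distinct ne)) gb)
      ...   | inj₂ zz = inj₂ (trans (un (fs k') (fs-distinct ne)) zz)
    byState : GuardedBranch h k ⊎ h (fs k) ≡ 0 → Strat σ h
    byState (inj₂ zz) = finishAll c (suc i) σ h eq' h0 g r3 done' st
      where
      done' : ∀ k' → toℕ k' < suc i → h (fs k') ≡ 0
      done' k' lt with k' FP.≟ k
      ... | yes refl = zz
      ... | no ne = done< k' (below-next k' lt ne)
    byState (inj₁ (inj₁ (f0 , hk))) =
      finishBranch₀ σ h h (3 * L) 0 f0 inv hk (λ _ _ → refl) r3 allClear 3L≥1 ≤-refl continue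
      where
      3L≥1 : 1 ≤ 3 * L
      3L≥1 = ≤-trans L≥1 (m≤m+n L _)
    byState (inj₁ (inj₂ (m , ml , hk))) =
      finishBranch σ h h (3 * L) 0 m ml (≤-trans (s≤s z≤n) ml) inv hk (λ _ _ → refl) r3 allClear
        3L≥1 ≤-refl (≤-trans (m≤m+n (2 * L) L) (≤-reflexive (+-comm (2 * L) L)))
        (λ t' lt → ≤-trans (p≤L k t' (<⇒≤ lt)) (m≤m+n L _))
        (≤-trans (p≤L k 0 z≤n) (m+n≤o⇒m≤o∸n L (+-monoʳ-≤ L (≤-trans L≥1 (m≤m+n L _))))) continue
      where
      3L≥1 : 1 ≤ 3 * L
      3L≥1 = ≤-trans L≥1 (m≤m+n L _)

  -- Invariant of the scan over times T (phase (1)): G searchers are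
  -- guards, with G + C_ℓ ≤ T; the tasks k ≠ ℓ starting before T have
  -- guarded branches, the others (and ℓ) untouched branches.
  record ScanInv (σ : V → ℕ) (h : Heights) (T G : ℕ) : Set where
    field
      baseClear     : h fz ≡ 0
      guarded       : Guarded σ h
      enoughAtRoot  : 4 * L ≤ G + σ r
      guardsBound   : G + C ℓ ≤ T
      T≤L           : T ≤ L
      ℓ-untouched   : h (fs ℓ) ≡ 4 + 2 * f ℓ
      started       : ∀ k → k ≢ ℓ → s k < T → GuardedBranch h k
      notStarted    : ∀ k → k ≢ ℓ → T ≤ s k → h (fs k) ≡ 4 + 2 * f k
  open ScanInv

  -- Phase (2): all remaining 4L − G ≥ 3L searchers treat branch fs ℓ, with
  -- the guard p_ℓ(0) ≤ C_ℓ on v_ℓ^0; afterwards phase (3) takes over.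
  lastBranch : ∀ σ h T G → ScanInv σ h T G → L ≤ T → Strat σ h
  lastBranch σ h T G si L≤T = byLength (zero-or-positive (f ℓ))
    where
    G+Cℓ≤L : G + C ℓ ≤ L
    G+Cℓ≤L = ≤-trans (guardsBound si) (T≤L si)
    g : ℕ
    g = 4 * L ∸ G
    g≤root : 0 + g ≤ σ r
    g≤root = m≤n+o⇒m∸n≤o (4 * L) G (enoughAtRoot si)
    3L≤g : 3 * L ≤ g
    3L≤g = ≤-trans (≤-reflexive (sym (m+n∸m≡n L (3 * L))))
                   (∸-monoʳ-≤ (4 * L) (≤-trans (m≤m+n G (C ℓ)) G+Cℓ≤L))
    others : ∀ k → k ≢ ℓ → GuardedBranch h k
    others k ne = started si k ne (≤-trans (s<L k) L≤T)
    inv : Inv ℓ σ h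
    inv = invFrom σ h ℓ (baseClear si) (guarded si)
            (inj₁ (≤-trans (≤-trans (m≤m+n (2 * L) L) (≤-reflexive (+-comm (2 * L) L))) (≤-trans 3L≤g g≤root)))
    othersClear : (2 * L ≤ 0) ⊎ (∀ k → k ≢ ℓ → h (fs k) ≤ 3 + 2 * f k)
    othersClear = inj₂ λ k ne → guarded-ru-clear h k (others k ne)
    3L-return : ∀ {s'} → 0 + (g ∸ p ℓ 0) ≤ s' → 3 * L ≤ s'
    3L-return q = ≤-trans (≤-trans (≤-reflexive (sym (m+n∸m≡n L (3 * L))))
                    (≤-trans (∸-monoʳ-≤ (4 * L) (≤-trans (+-monoʳ-≤ G pℓ0≤Cℓ) G+Cℓ≤L))
                             (≤-reflexive (sym (∸-+-assoc (4 * L) G (p ℓ 0)))))) q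
      where
      pℓ0≤Cℓ : p ℓ 0 ≤ C ℓ
      pℓ0≤Cℓ = ≤-trans (p-mono ℓ 0 (s ℓ) z≤n (inDomain ℓ)) (m≤n+m _ (s ℓ))
    L<g : L < g
    L<g = ≤-trans (≤-trans (≤-reflexive (+-comm 1 L)) (+-monoʳ-≤ L (≤-trans L≥1 (m≤m+n L _)))) 3L≤g
    open Branch ℓ
    toPhase3 : ∀ H → (∀ h' → h' (fs ℓ) ≡ H → GuardedBranch h' ℓ) → ContHome h H (0 + (g ∸ p ℓ 0))
    toPhase3 H gℓ σ' h' inv' hℓ un back =
      finishAll n 0 σ' h' refl (clearBase inv') (guardedFrom inv') (3L-return back) (λ k ()) settled
      where
      settled : Settled h'
      settled k with k FP.≟ ℓ
      ... | yes refl = inj₁ (gℓ h' hℓ)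
      ... | no ne = inj₁ (guardedBranch-cong h h' k (un (fs k) (fs-distinct ne)) (others k ne))
    byLength : f ℓ ≡ 0 ⊎ 1 ≤ f ℓ → Strat σ h
    byLength (inj₁ f0) = guardBranch₀ σ h h g 0 f0 inv (ℓ-untouched si) (λ _ _ → refl) g≤root othersClear
      (≤-trans (m∸n≤m (2 * L) (f ℓ)) (≤-trans (≤-trans 2L≤3L-1 (m∸n≤m _ 1)) 3L≤g))
      (≤-trans (s≤s (p≤L ℓ 0 z≤n)) L<g)
      (toPhase3 2 (λ h' e → inj₁ (f0 , e)))
    byLength (inj₂ f1) = guardBranch σ h h g 0 0 f1 f1 inv (ℓ-untouched si) (λ _ _ → refl) g≤root othersClear
      (≤-trans (m∸n≤m (2 * L) (f ℓ)) (≤-trans 2L≤3L-1 (∸-monoˡ-≤ 1 3L≤g)))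
      (λ t' _ _ → ≤-trans (m∸n≤m (2 * L) t') (≤-trans (≤-trans 2L≤3L-1 (m∸n≤m _ 1)) 3L≤g))
      (λ t' lt → ≤-trans (p≤L ℓ t' (<⇒≤ lt)) (<⇒≤ L<g))
      (≤-trans (s≤s (p≤L ℓ 0 z≤n)) L<g)
      (toPhase3 3 (λ h' e → inj₂ (0 , f1 , e)))

  nothingStarts : ∀ {σ h T G} → ScanInv σ h T G → ¬ (L ≤ T) →
                  ¬ (Σ (Fin n) λ k → ¬ k ≡ ℓ × s k ≡ T) → ScanInv σ h (suc T) G
  nothingStarts {h = h} {T = T} si nle none = record
    { baseClear = baseClear si ; guarded = guarded si ; enoughAtRoot = enoughAtRoot si
    ; ℓ-untouched = ℓ-untouched si
    ; guardsBound = ≤-trans (guardsBound si) (n≤1+n T)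
    ; T≤L = ≰⇒> nle
    ; started = λ k ne lt → atOrBefore k ne (m≤n⇒m<n∨m≡n (≤-pred lt))
    ; notStarted = λ k ne le → notStarted si k ne (≤-trans (n≤1+n T) le) }
    where
    atOrBefore : ∀ k → k ≢ ℓ → (s k < T) ⊎ (s k ≡ T) → GuardedBranch h k
    atOrBefore k ne (inj₁ q) = started si k ne q
    atOrBefore k ne (inj₂ q) = ⊥-elim (none (k , ne , q))

  guardTask : ∀ c σ h T G → L ≤ T + suc c → ScanInv σ h T G →
              ∀ k → k ≢ ℓ → s k ≡ T → Strat σ h

  -- Phase (1): scan the times T = C_ℓ, C_ℓ + 1, …; at a time T at which a
  -- task k ≠ ℓ starts, a team of 2L − G searchers guards branch fs k with
  -- p_k(m) searchers, m = min(s_k, f_k − 1), and the scan resumes at C_k.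
  -- The fuel c bounds the number of remaining times.
  scan : ∀ c σ h T G → L ≤ T + c → ScanInv σ h T G → Strat σ h
  scan zero σ h T G L≤ si = lastBranch σ h T G si (subst (L ≤_) (+-identityʳ T) L≤)
  scan (suc c) σ h T G L≤ si with L ≤? T
  ... | yes le = lastBranch σ h T G si le
  ... | no nle with FP.any? (λ k → ¬? (k FP.≟ ℓ) ×-dec (s k ≟ T))
  ...   | no none = scan c σ h (suc T) G (≤-trans L≤ (≤-reflexive (+-suc T c))) (nothingStarts si nle none)
  ...   | yes (k , k≢ℓ , sk≡T) = guardTask c σ h T G L≤ si k k≢ℓ sk≡T

  guardTask c σ h T G L≤ si k k≢ℓ sk≡T =
    guardBranch σ h h g (2 * L) m m<f f≥1 inv untouched (λ _ _ → refl) root (inj₁ ≤-refl)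
      top-weight lower-weights v-weights guard<g resume
    where
    untouched : h (fs k) ≡ 4 + 2 * f k
    untouched = notStarted si k k≢ℓ (≤-reflexive (sym sk≡T))
    G+1≤s : G + 1 ≤ s k
    G+1≤s = subst (G + 1 ≤_) (sym sk≡T) (≤-trans (+-monoʳ-≤ G (≤-trans (s≤s z≤n) (s<C ℓ))) (guardsBound si))
    f≥1 : 1 ≤ f k
    f≥1 = ≤-trans (m≤n+m 1 G) (≤-trans G+1≤s (s≤f k))
    m : ℕ
    m = s k ⊓ (f k ∸ 1)
    m<f : m < f k
    m<f = ≤-trans (s≤s (m⊓n≤n (s k) (f k ∸ 1))) (≤-reflexive (trans (+-comm 1 (f k ∸ 1)) (m∸n+n≡m f≥1)))
    G≤m : G ≤ m
    G≤m = ⊓-glb (m+n≤o⇒m≤o G G+1≤s) (m+n≤o⇒m≤o∸n G (≤-trans G+1≤s (s≤f k)))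
    G<L : G < L
    G<L = ≤-trans (≤-trans (≤-reflexive (+-comm 1 G)) G+1≤s) (<⇒≤ (s<L k))
    g : ℕ
    g = 2 * L ∸ G
    root : 2 * L + g ≤ σ r
    root = ≤-trans (≤-reflexive (trans (sym (+-∸-assoc (2 * L) (≤-trans (<⇒≤ G<L) (m≤m+n L _))))
                                       (cong (_∸ G) (sym fourL))))
                   (m≤n+o⇒m∸n≤o (4 * L) G (enoughAtRoot si))
    top-weight : 2 * L ∸ f k ≤ g ∸ 1
    top-weight = ≤-trans (∸-monoʳ-≤ (2 * L) (≤-trans G+1≤s (s≤f k))) (≤-reflexive (sym (∸-+-assoc (2 * L) G 1)))
    lower-weights : ∀ t' → m < t' → t' < f k → 2 * L ∸ t' ≤ g
    lower-weights t' mt _ = ∸-monoʳ-≤ (2 * L) (≤-trans G≤m (<⇒≤ mt))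
    L<g : L < g
    L<g = subst (L <_) (sym (trans (cong (_∸ G) twoL) (+-∸-assoc L (<⇒≤ G<L))))
            (≤-trans (≤-reflexive (+-comm 1 L)) (+-monoʳ-≤ L (m+n≤o⇒m≤o∸n 1 G<L)))
    v-weights : ∀ t' → t' < f k → p k t' ≤ g
    v-weights t' lt = ≤-trans (p≤L k t' (<⇒≤ lt)) (<⇒≤ L<g)
    guard<g : p k m < g
    guard<g = ≤-trans (s≤s (p≤L k m (<⇒≤ m<f))) L<g
    inv : Inv k σ h
    inv = invFrom σ h k (baseClear si) (guarded si) (inj₁ (≤-trans (m≤m+n (2 * L) g) root))
    guard≤p : p k m ≤ p k (s k)
    guard≤p = p-mono k m (s k) (m⊓n≤m (s k) (f k ∸ 1)) (inDomain k)
    open Branch k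
    resume : ContHome h (3 + 2 * m) (2 * L + (g ∸ p k m))
    resume σ' h' inv' hk un back = scan c σ' h' (C k) (G + p k m) L≤' si'
      where
      guards≤ : (G + p k m) + C ℓ ≤ C k
      guards≤ = ≤-trans (≤-reflexive (trans (+-assoc G (p k m) (C ℓ))
                          (trans (cong (G +_) (+-comm (p k m) (C ℓ))) (sym (+-assoc G (C ℓ) (p k m))))))
                  (+-mono-≤ (subst (G + C ℓ ≤_) (sym sk≡T) (guardsBound si)) guard≤p)
      guards≤2L : G + p k m ≤ 2 * L
      guards≤2L = ≤-trans (m≤m+n _ (C ℓ)) (≤-trans guards≤ (≤-trans (C≤L k) (m≤m+n L _)))
      L≤' : L ≤ C k + c
      L≤' = ≤-trans L≤ (≤-trans (≤-reflexive (+-suc T c)) (+-monoˡ-≤ c (subst (_< C k) sk≡T (s<C k))))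
      si' : ScanInv σ' h' (C k) (G + p k m)
      si' = record
        { baseClear = clearBase inv' ; guarded = guardedFrom inv'
        ; enoughAtRoot = ≤-trans (≤-reflexive fourL)
            (rejoined guards≤2L (subst (λ z → 2 * L + z ≤ σ' r) (∸-+-assoc (2 * L) G (p k m)) back))
        ; guardsBound = guards≤ ; T≤L = C≤L k
        ; ℓ-untouched = trans (un (fs ℓ) (fs-distinct (λ e → k≢ℓ (sym e)))) (ℓ-untouched si)
        ; started = started' ; notStarted = notStarted' }
        where
        -- tasks starting in [T, C_k) other than k itself do not exist
        started' : ∀ k' → k' ≢ ℓ → s k' < C k → GuardedBranch h' k'
        started' k' ne lt with k' FP.≟ k
        ... | yes refl = inj₂ (m , m<f , hk)
        ... | no nk with s k' <? T
        ...   | yes q = guardedBranch-cong h h' k' (un (fs k') (fs-distinct nk)) (started si k' ne q)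
        ...   | no q = ⊥-elim (<⇒≱ lt (finishes-first k k' (λ e → nk (sym e))
                                        (subst (_≤ s k') (sym sk≡T) (≮⇒≥ q))))
        notStarted' : ∀ k' → k' ≢ ℓ → C k ≤ s k' → h' (fs k') ≡ 4 + 2 * f k'
        notStarted' k' ne le with k' FP.≟ k
        ... | yes refl = ⊥-elim (<⇒≱ (s<C k) le)
        ... | no nk = trans (un (fs k') (fs-distinct nk))
                (notStarted si k' ne (subst (_≤ s k') sk≡T (≤-trans (m≤m+n (s k) _) le)))

  -- at the end of phase (0), i.e. at time C_ℓ, no other task has started
  scanStart : ∀ σ → 4 * L ≤ σ r → ScanInv σ hStart (C ℓ) 0
  scanStart σ r4 = record
    { baseClear = refl ; guarded = guarded-hStart σ ; enoughAtRoot = r4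
    ; guardsBound = ≤-refl ; T≤L = C≤L ℓ ; ℓ-untouched = refl
    ; started = λ k ne lt → ⊥-elim (<⇒≱ lt (finishes-first ℓ k (λ e → ne (sym e)) (ℓ-first k)))
    ; notStarted = λ k ne le → refl }

  fromStart : ∀ σ → 4 * L ≤ σ r → Strat σ hStart
  fromStart σ r4 = scan L σ hStart (C ℓ) 0 (m≤n+m L (C ℓ)) (scanStart σ r4)

corollary1 : (n : ℕ) → 1 ≤ n →
    (d : Fin n → ℕ) (p : Fin n → ℕ → ℕ) →
    (∀ j t → t < d j → 1 ≤ p j t) →
    (∀ j t t′ → t ≤ t′ → t′ < d j → p j t ≤ p j t′) →
    (f : Fin n → ℕ) → (∀ j → IsLatestStart (d j) (p j) (f j)) →
    FeasibleSchedule n d p →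
    ConnectedSearch (tree n d p f) (4 * maxFin n d) (r {n} {f})
corollary1 n n≥1 d p p≥1 p-mono f latest sched = record
  { σ₀ = onlyAt r (4 * L)
  ; atStart = onlyAt-here r (4 * L)
  ; empty = onlyAt-elsewhere r (4 * L)
  ; strategy = Phase0.run ℓ L≥1 (onlyAt r (4 * L)) (onlyAt-here r (4 * L)) fromStart }
  where
  open Schedule n n≥1 d p p≥1 p-mono f latest sched
  open TreeM n d p f
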